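{- Let $\mathcal{L}\in\{\mathsf{K},\mathsf{K4},\mathsf{T},\mathsf{S4}\}$, and let $\mathcal{C}$ be, respectively, a Kripke category, a Kripke-4 category, a Kripke-T category, or a Bierman-de Paiva category, together with an interpretation $\mathcal{I}$ of base types as objects of $\mathcal{C}$. If $\Delta;\Gamma\vdash_{\mathsf{D}\mathcal{L}} M=N:A$, then $[\![\Delta;\Gamma\vdash M:A]\!]_{\mathcal{L}}=[\![\Delta;\Gamma\vdash N:A]\!]_{\mathcal{L}}$ as morphisms $[\![\Delta;\Gamma]\!]\to[\![A]\!]$ in $\mathcal{C}$.
   Context: Calculi. Types $A ::= p_i\mid A\times B\mid A\to B\mid\Box A$; terms $x\mid\lambda x{:}A.M\mid MN\mid\langle M,N\rangle\mid\pi_i(M)\mid\mathsf{box}\,M\mid\mathsf{let\ box}\ u\Leftarrow M\ \mathsf{in}\ N$ ($u$ bound in $N$), up to $\alpha$; judgments $\Delta;\Gamma\vdash M:A$ with modal context $\Delta$ and intuitionistic context $\Gamma$ having disjoint variables (in $\mathsf{DK4}$ also no variable occurs with its complement in the same context, where $(-)^\bot$ is a fixed involution on variables extended to contexts pointwise and to terms by complementing variables homomorphically, with $\lambda x{:}A.M\mapsto\lambda x^\bot{:}A.M^\bot$, leaving $\mathsf{box}\,M$ unchanged and mapping $\mathsf{let\ box}\ u\Leftarrow M\ \mathsf{in}\ N$ to $\mathsf{let\ box}\ u\Leftarrow M^\bot\ \mathsf{in}\ N^\bot$). Common rules: variable $\Delta;\Gamma,x{:}A,\Gamma'\vdash x:A$;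 standard rules for pairs, projections, $\lambda$ and application in context $\Delta;\Gamma$; from $\Delta;\Gamma\vdash M:\Box A$ and $\Delta,u{:}A;\Gamma\vdash N:C$ infer $\Delta;\Gamma\vdash\mathsf{let\ box}\ u\Leftarrow M\ \mathsf{in}\ N:C$. $\mathsf{DK}$: from $\cdot;\Delta\vdash M:A$ infer $\Delta;\Gamma\vdash\mathsf{box}\,M:\Box A$. $\mathsf{DK4}$: from $\Delta;\Delta^\bot\vdash M^\bot:A$ infer $\Delta;\Gamma\vdash\mathsf{box}\,M:\Box A$. $\mathsf{DS4}$: $\Delta,u{:}A,\Delta';\Gamma\vdash u:A$, and from $\Delta;\cdot\vdash M:A$ infer $\Delta;\Gamma\vdash\mathsf{box}\,M:\Box A$. $\mathsf{DT}$: the $\mathsf{DK}$ box rule and $\Delta,u{:}A,\Delta';\Gamma\vdash u:A$. Equational theory $\Delta;\Gamma\vdash_{\mathsf{D}\mathcal{L}}M=N:A$: the least relation, between terms of type $A$ in context $\Delta;\Gamma$, that is reflexive, symmetric and transitive, closed under congruence for $\lambda$-abstraction and application, and containing: $(\lambda x{:}A.M)N=M[N/x]$ (when $\Delta;\Gamma,x{:}A\vdash M:B$, $\Delta;\Gamma\vdash N:A$); $M=\lambda x{:}A.Mx$ (for $M:A\to B$, $x\notin\mathrm{fv}(M)$); $\mathsf{let\ box}\ u\Leftarrow M\ \mathsf{in}\ \mathsf{box}\,u=M$ (for $M:\Box A$); if $M=N:\Box A$ and $P=Q:C$ (the latter in context $\Delta,u{:}A;\Gamma$) then $\mathsf{let\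 box}\ u\Leftarrow M\ \mathsf{in}\ P=\mathsf{let\ box}\ u\Leftarrow N\ \mathsf{in}\ Q:C$; and a $\beta$-rule $\mathsf{let\ box}\ u\Leftarrow\mathsf{box}\,M\ \mathsf{in}\ N=N[M/u]:C$ and a congruence rule $\mathsf{box}\,M=\mathsf{box}\,N:\Box A$, each under the premises of the respective box-introduction rule: for $\mathsf{DK},\mathsf{DT}$ premise $\cdot;\Delta\vdash M:A$ (resp. $\cdot;\Delta\vdash M=N:A$); for $\mathsf{DK4}$ premise $\Delta;\Delta^\bot\vdash M^\bot:A$ (resp. $\Delta;\Delta^\bot\vdash M^\bot=N^\bot:A$); for $\mathsf{DS4}$ premise $\Delta;\cdot\vdash M:A$ (resp. $\Delta;\cdot\vdash M=N:A$); the $\beta$-rule also requires $\Delta,u{:}A;\Gamma\vdash N:C$. Categories. A Kripke category is a cartesian closed category $\mathcal{C}$ with a strong monoidal endofunctor $F$ (w.r.t. the cartesian monoidal structure): a functor with natural isomorphisms $m_{A,B}:FA\times FB\to F(A\times B)$ and an isomorphism $m_0:\mathbf{1}\to F\mathbf{1}$ satisfying the usual lax-monoidal coherence axioms. Products $\prod_{i=1}^n A_i$ associate to the left; $m^{(0)}=m_0$, $m^{(n+1)}=m\circ(m^{(n)}\times\mathrm{id}):\prod_{i=1}^{n+1}FA_i\to F(\prod_{i=1}^{n+1}A_i)$. For $f:\prod_{i=1}^nA_i\to B$ put $f^\bullet=Ff\circ m^{(n)}:\prod FA_i\to FB$. A Kripke-4 category is a Kripke category with a monoidal natural transformation $\delta:F\Rightarrow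 F^2$ with $\delta_{FA}\circ\delta_A=F(\delta_A)\circ\delta_A$; for $f:\prod_{i=1}^nFA_i\times\prod_{i=1}^nA_i\to B$ put $f^\#=Ff\circ m^{(2n)}\circ\langle\delta_{A_1}\pi_1,\dots,\delta_{A_n}\pi_n,\pi_1,\dots,\pi_n\rangle:\prod FA_i\to FB$. A Kripke-T category is a Kripke category with a monoidal natural transformation $\epsilon:F\Rightarrow\mathrm{Id}$. A Bierman-de Paiva category is a Kripke category whose $F$ is part of a monoidal comonad $(F,\epsilon,\delta)$ (comonad whose counit and comultiplication are monoidal natural transformations); for $f:\prod_{i=1}^nFA_i\to B$ put $f^\ast=Ff\circ m^{(n)}\circ\prod_{i=1}^n\delta_{A_i}$. Semantics. $[\![p_i]\!]=\mathcal{I}(p_i)$, $[\![A\times B]\!]=[\![A]\!]\times[\![B]\!]$, $[\![A\to B]\!]$ the exponential $[\![B]\!]^{[\![A]\!]}$, $[\![\Box A]\!]=F[\![A]\!]$. For $\Delta=u_1{:}B_1,\dots,u_n{:}B_n$, $\Gamma=x_1{:}A_1,\dots,x_m{:}A_m$: $[\![\Delta;\Gamma]\!]=F[\![B_1]\!]\times\cdots\times F[\![B_n]\!]\times[\![A_1]\!]\times\cdots\times[\![A_m]\!]$ (left-associated, $\mathbf{1}$ if empty). Each derivation is interpreted by induction as a morphism $[\![\Delta;\Gamma]\!]\to[\![A]\!]$: intuitionistic variables, pairs, projections, $\lambda$ and application by the standard cartesian-closed interpretation (projections, pairing, currying, evaluation); $[\![\mathsf{let\ box}\ u\Leftarrow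 M\ \mathsf{in}\ N]\!]=[\![\Delta,u{:}A;\Gamma\vdash N:C]\!]\circ\langle\pi_1,\dots,\pi_n,[\![\Delta;\Gamma\vdash M:\Box A]\!],\pi_{n+1},\dots,\pi_{n+m}\rangle$; for $\mathsf{T}$ and $\mathsf{S4}$, a modal variable $\Delta,u{:}A,\Delta';\Gamma\vdash u:A$ is $\epsilon_{[\![A]\!]}\circ\pi$ with $\pi$ the projection onto $F[\![A]\!]$; writing $\pi_\Delta:[\![\Delta;\Gamma]\!]\to[\![\Delta;\cdot]\!]$ for the projection, $[\![\mathsf{box}\,M]\!]_{\mathsf{K}}=[\![\mathsf{box}\,M]\!]_{\mathsf{T}}=([\![\cdot;\Delta\vdash M:A]\!])^\bullet\circ\pi_\Delta$, $[\![\mathsf{box}\,M]\!]_{\mathsf{K4}}=([\![\Delta;\Delta^\bot\vdash M^\bot:A]\!])^\#\circ\pi_\Delta$, $[\![\mathsf{box}\,M]\!]_{\mathsf{S4}}=([\![\Delta;\cdot\vdash M:A]\!])^\ast\circ\pi_\Delta$. -}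

module Defs where

open import Level using (Level; _⊔_) renaming (suc to lsuc)
open import Data.Nat using (ℕ)
open import Data.Empty using (⊥)
open import Data.Unit using (⊤; tt)
open import Relation.Binary using (Rel; IsEquivalence)

infixl 5 _▸_
data SL {a} (X : Set a) : Set a where
  []  : SL X
  _▸_ : SL X → X → SL X

mapSL : ∀ {a b} {X : Set a} {Y : Set b} → (X → Y) → SL X → SL Y
mapSL f []       = []
mapSL f (xs ▸ x) = mapSL f xs ▸ f x

infix 4 _∋_
data _∋_ {a} {X : Set a} : SL X → X → Set a where
  here  : ∀ {xs x} → (xs ▸ x) ∋ x
  there : ∀ {xs x y} → xs ∋ x → (xs ▸ y) ∋ x

infixr 7 _⇒ᵗ_
infixr 8 _×ᵗ_
data Ty : Set where
  base  : ℕ → Ty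
  _×ᵗ_  : Ty → Ty → Ty
  _⇒ᵗ_  : Ty → Ty → Ty
  □_    : Ty → Ty

Ctx : Set
Ctx = SL Ty

data Logic : Set where
  LK LK4 LT LS4 : Logic

-- contexts (modal ; intuitionistic) of the premise of the box rule
-- whose conclusion is in modal context Δ
BΔ : Logic → Ctx → Ctx
BΔ LK  Δ = []
BΔ LK4 Δ = Δ
BΔ LT  Δ = []
BΔ LS4 Δ = Δ

BΓ : Logic → Ctx → Ctx
BΓ LK  Δ = Δ
BΓ LK4 Δ = Δ     -- Δ^⊥ (complemented names; irrelevant with de Bruijn indices)
BΓ LT  Δ = Δ
BΓ LS4 Δ = []

HasMVar : Logic → Set
HasMVar LK  = ⊥
HasMVar LK4 = ⊥
HasMVar LT  = ⊤
HasMVar LS4 = ⊤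

-- Intrinsically typed terms (typing derivations), Tm L Δ Γ A  ~  Δ;Γ ⊢ M : A
-- For K4 the box body stored is M^⊥, typed in Δ;Δ^⊥.

data Tm (L : Logic) : Ctx → Ctx → Ty → Set where
  var    : ∀ {Δ Γ A} → Γ ∋ A → Tm L Δ Γ A
  mvar   : ∀ {Δ Γ A} → HasMVar L → Δ ∋ A → Tm L Δ Γ A
  lam    : ∀ {Δ Γ A B} → Tm L Δ (Γ ▸ A) B → Tm L Δ Γ (A ⇒ᵗ B)
  app    : ∀ {Δ Γ A B} → Tm L Δ Γ (A ⇒ᵗ B) → Tm L Δ Γ A → Tm L Δ Γ B
  pair   : ∀ {Δ Γ A B} → Tm L Δ Γ A → Tm L Δ Γ B → Tm L Δ Γ (A ×ᵗ B)
  prj₁   : ∀ {Δ Γ A B} → Tm L Δ Γ (A ×ᵗ B) → Tm L Δ Γ A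
  prj₂   : ∀ {Δ Γ A B} → Tm L Δ Γ (A ×ᵗ B) → Tm L Δ Γ B
  box    : ∀ {Δ Γ A} → Tm L (BΔ L Δ) (BΓ L Δ) A → Tm L Δ Γ (□ A)
  letbox : ∀ {Δ Γ A C} → Tm L Δ Γ (□ A) → Tm L (Δ ▸ A) Γ C → Tm L Δ Γ C

Ren : Ctx → Ctx → Set
Ren Γ Γ' = ∀ {A} → Γ ∋ A → Γ' ∋ A

liftR : ∀ {Γ Γ' B} → Ren Γ Γ' → Ren (Γ ▸ B) (Γ' ▸ B)
liftR ρ here      = here
liftR ρ (there x) = there (ρ x)

rn : ∀ {L Δ Δ' Γ Γ' A} → Ren Δ Δ' → Ren Γ Γ' → Tm L Δ Γ A → Tm L Δ' Γ' A
rn ρ σ (var x)      = var (σ x)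
rn ρ σ (mvar h u)   = mvar h (ρ u)
rn ρ σ (lam M)      = lam (rn ρ (liftR σ) M)
rn ρ σ (app M N)    = app (rn ρ σ M) (rn ρ σ N)
rn ρ σ (pair M N)   = pair (rn ρ σ M) (rn ρ σ N)
rn ρ σ (prj₁ M)     = prj₁ (rn ρ σ M)
rn ρ σ (prj₂ M)     = prj₂ (rn ρ σ M)
rn ρ σ (letbox M N) = letbox (rn ρ σ M) (rn (liftR ρ) σ N)
rn {LK}  ρ σ (box M) = box (rn (λ ()) ρ M)
rn {LK4} ρ σ (box M) = box (rn ρ ρ M)
rn {LT}  ρ σ (box M) = box (rn (λ ()) ρ M)
rn {LS4} ρ σ (box M) = box (rn ρ (λ ()) M)

rnB : ∀ L {Δ Δ' A} → Ren Δ Δ' → Tm L (BΔ L Δ) (BΓ L Δ) A → Tm L (BΔ L Δ') (BΓ L Δ') A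
rnB LK  ρ M = rn (λ ()) ρ M
rnB LK4 ρ M = rn ρ ρ M
rnB LT  ρ M = rn (λ ()) ρ M
rnB LS4 ρ M = rn ρ (λ ()) M

Sub : Logic → Ctx → Ctx → Ctx → Set
Sub L Δ' Γ Γ' = ∀ {B} → Γ ∋ B → Tm L Δ' Γ' B

sub : ∀ {L Δ Δ' Γ Γ' A} → Ren Δ Δ' → Sub L Δ' Γ Γ' → Tm L Δ Γ A → Tm L Δ' Γ' A
sub ρ σ (var x)      = σ x
sub ρ σ (mvar h u)   = mvar h (ρ u)
sub ρ σ (lam M)      = lam (sub ρ liftσ M)
  where
    liftσ : Sub _ _ _ _
    liftσ here      = var here
    liftσ (there x) = rn (λ u → u) there (σ x)
sub ρ σ (app M N)    = app (sub ρ σ M) (sub ρ σ N)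
sub ρ σ (pair M N)   = pair (sub ρ σ M) (sub ρ σ N)
sub ρ σ (prj₁ M)     = prj₁ (sub ρ σ M)
sub ρ σ (prj₂ M)     = prj₂ (sub ρ σ M)
sub ρ σ (letbox M N) = letbox (sub ρ σ M) (sub (liftR ρ) (λ x → rn there (λ y → y) (σ x)) N)
sub {L} ρ σ (box M)  = box (rnB L ρ M)

-- the box body "u" for a modal variable u (as in  box u)
uId : ∀ L {Δ A} → Δ ∋ A → Tm L (BΔ L Δ) (BΓ L Δ) A
uId LK  u = var u
uId LK4 u = var u
uId LT  u = var u
uId LS4 u = mvar tt u

-- substitution of box bodies for modal variables
MSub : Logic → Ctx → Ctx → Set
MSub L Δ Δ' = ∀ {B} → Δ ∋ B → Tm L (BΔ L Δ') (BΓ L Δ') B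

mlift : ∀ L {Δ Δ' C} → MSub L Δ Δ' → MSub L (Δ ▸ C) (Δ' ▸ C)
mlift L σ here      = uId L here
mlift L σ (there u) = rnB L there (σ u)

msub : ∀ {L Δ Δ' Γ A} → MSub L Δ Δ' → Tm L Δ Γ A → Tm L Δ' Γ A
msub σ (var x)      = var x
msub σ (lam M)      = lam (msub σ M)
msub σ (app M N)    = app (msub σ M) (msub σ N)
msub σ (pair M N)   = pair (msub σ M) (msub σ N)
msub σ (prj₁ M)     = prj₁ (msub σ M)
msub σ (prj₂ M)     = prj₂ (msub σ M)
msub {L} σ (letbox M N) = letbox (msub σ M) (msub (mlift L σ) N)
msub {LK}  σ (mvar () u)
msub {LK4} σ (mvar () u)
msub {LT}  σ (mvar h u) = sub (λ ()) (λ x → mvar tt x) (σ u)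
msub {LS4} σ (mvar h u) = rn (λ v → v) (λ ()) (σ u)
msub {LK}  σ (box B) = box (sub (λ ()) σ B)
msub {LK4} σ (box B) = box (sub (λ v → v) σ (msub σ B))
msub {LT}  σ (box B) = box (sub (λ ()) σ B)
msub {LS4} σ (box B) = box (msub σ B)

single : ∀ {L Δ Γ A} → Tm L Δ Γ A → Sub L Δ (Γ ▸ A) Γ
single N here      = N
single N (there x) = var x

msingle : ∀ L {Δ A} → Tm L (BΔ L Δ) (BΓ L Δ) A → MSub L (Δ ▸ A) Δ
msingle L M here      = M
msingle L M (there u) = uId L u

infix 3 _⊢_≐_
data _⊢_≐_ (L : Logic) : ∀ {Δ Γ A} → Tm L Δ Γ A → Tm L Δ Γ A → Set where
  ≐refl  : ∀ {Δ Γ A} {M : Tm L Δ Γ A} → L ⊢ M ≐ M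
  ≐sym   : ∀ {Δ Γ A} {M N : Tm L Δ Γ A} → L ⊢ M ≐ N → L ⊢ N ≐ M
  ≐trans : ∀ {Δ Γ A} {M N P : Tm L Δ Γ A} → L ⊢ M ≐ N → L ⊢ N ≐ P → L ⊢ M ≐ P
  cong-lam : ∀ {Δ Γ A B} {M N : Tm L Δ (Γ ▸ A) B} → L ⊢ M ≐ N → L ⊢ lam M ≐ lam N
  cong-app : ∀ {Δ Γ A B} {M M' : Tm L Δ Γ (A ⇒ᵗ B)} {N N' : Tm L Δ Γ A} →
             L ⊢ M ≐ M' → L ⊢ N ≐ N' → L ⊢ app M N ≐ app M' N'
  β⇒ : ∀ {Δ Γ A B} {M : Tm L Δ (Γ ▸ A) B} {N : Tm L Δ Γ A} →
       L ⊢ app (lam M) N ≐ sub (λ u → u) (single N) M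
  η⇒ : ∀ {Δ Γ A B} {M : Tm L Δ Γ (A ⇒ᵗ B)} →
       L ⊢ M ≐ lam (app (rn (λ u → u) there M) (var here))
  η□ : ∀ {Δ Γ A} {M : Tm L Δ Γ (□ A)} →
       L ⊢ letbox M (box (uId L here)) ≐ M
  cong-let : ∀ {Δ Γ A C} {M N : Tm L Δ Γ (□ A)} {P Q : Tm L (Δ ▸ A) Γ C} →
             L ⊢ M ≐ N → L ⊢ P ≐ Q → L ⊢ letbox M P ≐ letbox N Q
  β□ : ∀ {Δ Γ A C} {M : Tm L (BΔ L Δ) (BΓ L Δ) A} {N : Tm L (Δ ▸ A) Γ C} →
       L ⊢ letbox (box M) N ≐ msub (msingle L M) N
  cong-box : ∀ {Δ Γ A} {M N : Tm L (BΔ L Δ) (BΓ L Δ) A} →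
             L ⊢ M ≐ N → L ⊢ box {Γ = Γ} M ≐ box N

record CCC (o ℓ e : Level) : Set (lsuc (o ⊔ ℓ ⊔ e)) where
  infixr 9 _∘_
  infix  4 _≈_
  infixr 2 _⇒_
  infixr 7 _×_
  field
    Obj  : Set o
    _⇒_  : Obj → Obj → Set ℓ
    _≈_  : ∀ {A B} → Rel (A ⇒ B) e
    ≈-equiv : ∀ {A B} → IsEquivalence (_≈_ {A} {B})
    id   : ∀ {A} → A ⇒ A
    _∘_  : ∀ {A B C} → B ⇒ C → A ⇒ B → A ⇒ C
    ∘-resp-≈ : ∀ {A B C} {f h : B ⇒ C} {g i : A ⇒ B} → f ≈ h → g ≈ i → f ∘ g ≈ h ∘ i
    identityˡ : ∀ {A B} {f : A ⇒ B} → id ∘ f ≈ f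
    identityʳ : ∀ {A B} {f : A ⇒ B} → f ∘ id ≈ f
    assoc : ∀ {A B C D} {f : A ⇒ B} {g : B ⇒ C} {h : C ⇒ D} → (h ∘ g) ∘ f ≈ h ∘ (g ∘ f)
    𝟙 : Obj
    ! : ∀ {A} → A ⇒ 𝟙
    !-unique : ∀ {A} (f : A ⇒ 𝟙) → f ≈ !
    _×_ : Obj → Obj → Obj
    π₁ : ∀ {A B} → A × B ⇒ A
    π₂ : ∀ {A B} → A × B ⇒ B
    ⟨_,_⟩ : ∀ {A B C} → C ⇒ A → C ⇒ B → C ⇒ A × B
    project₁ : ∀ {A B C} {f : C ⇒ A} {g : C ⇒ B} → π₁ ∘ ⟨ f , g ⟩ ≈ f
    project₂ : ∀ {A B C} {f : C ⇒ A} {g : C ⇒ B} → π₂ ∘ ⟨ f , g ⟩ ≈ g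
    ⟨⟩-unique : ∀ {A B C} {f : C ⇒ A} {g : C ⇒ B} {h : C ⇒ A × B} →
                π₁ ∘ h ≈ f → π₂ ∘ h ≈ g → h ≈ ⟨ f , g ⟩
    _^_ : Obj → Obj → Obj
    eval : ∀ {A B} → (B ^ A) × A ⇒ B
    curry : ∀ {A B C} → C × A ⇒ B → C ⇒ B ^ A
    curry-β : ∀ {A B C} {f : C × A ⇒ B} → eval ∘ ⟨ curry f ∘ π₁ , id ∘ π₂ ⟩ ≈ f
    curry-unique : ∀ {A B C} {f : C × A ⇒ B} {h : C ⇒ B ^ A} →
                   eval ∘ ⟨ h ∘ π₁ , id ∘ π₂ ⟩ ≈ f → h ≈ curry f

module CCCOps {o ℓ e} (𝒞 : CCC o ℓ e) where
  open CCC 𝒞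
  infixr 8 _⁂_
  _⁂_ : ∀ {A B C D} → A ⇒ B → C ⇒ D → A × C ⇒ B × D
  f ⁂ g = ⟨ f ∘ π₁ , g ∘ π₂ ⟩
  αˣ : ∀ {A B C} → (A × B) × C ⇒ A × (B × C)
  αˣ = ⟨ π₁ ∘ π₁ , ⟨ π₂ ∘ π₁ , π₂ ⟩ ⟩
  λˣ : ∀ {A} → 𝟙 × A ⇒ A
  λˣ = π₂
  ρˣ : ∀ {A} → A × 𝟙 ⇒ A
  ρˣ = π₁

record Kripke (o ℓ e : Level) : Set (lsuc (o ⊔ ℓ ⊔ e)) where
  field
    ccc : CCC o ℓ e
  open CCC ccc public
  open CCCOps ccc public
  field
    F₀ : Obj → Obj
    F₁ : ∀ {A B} → A ⇒ B → F₀ A ⇒ F₀ B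
    F-id : ∀ {A} → F₁ (id {A}) ≈ id
    F-∘  : ∀ {A B C} {f : A ⇒ B} {g : B ⇒ C} → F₁ (g ∘ f) ≈ F₁ g ∘ F₁ f
    F-resp-≈ : ∀ {A B} {f g : A ⇒ B} → f ≈ g → F₁ f ≈ F₁ g
    m   : ∀ {A B} → F₀ A × F₀ B ⇒ F₀ (A × B)
    m⁻¹ : ∀ {A B} → F₀ (A × B) ⇒ F₀ A × F₀ B
    m-isoˡ : ∀ {A B} → m⁻¹ ∘ m {A} {B} ≈ id
    m-isoʳ : ∀ {A B} → m {A} {B} ∘ m⁻¹ ≈ id
    m-natural : ∀ {A B C D} {f : A ⇒ B} {g : C ⇒ D} → m ∘ (F₁ f ⁂ F₁ g) ≈ F₁ (f ⁂ g) ∘ m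
    m₀   : 𝟙 ⇒ F₀ 𝟙
    m₀⁻¹ : F₀ 𝟙 ⇒ 𝟙
    m₀-isoˡ : m₀⁻¹ ∘ m₀ ≈ id
    m₀-isoʳ : m₀ ∘ m₀⁻¹ ≈ id
    m-assoc : ∀ {A B C} → F₁ (αˣ {A} {B} {C}) ∘ m ∘ (m ⁂ id) ≈ m ∘ (id ⁂ m) ∘ αˣ
    m-unitˡ : ∀ {A} → F₁ (λˣ {A}) ∘ m ∘ (m₀ ⁂ id) ≈ λˣ
    m-unitʳ : ∀ {A} → F₁ (ρˣ {A}) ∘ m ∘ (id ⁂ m₀) ≈ ρˣ

record Four {o ℓ e} (𝒦 : Kripke o ℓ e) : Set (o ⊔ ℓ ⊔ e) where
  open Kripke 𝒦
  field
    δ : ∀ {A} → F₀ A ⇒ F₀ (F₀ A)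
    δ-natural : ∀ {A B} {f : A ⇒ B} → F₁ (F₁ f) ∘ δ ≈ δ ∘ F₁ f
    δ-monoidal : ∀ {A B} → δ {A × B} ∘ m ≈ F₁ m ∘ m ∘ (δ ⁂ δ)
    δ-monoidal₀ : δ ∘ m₀ ≈ F₁ m₀ ∘ m₀
    δ-4 : ∀ {A} → δ {F₀ A} ∘ δ {A} ≈ F₁ δ ∘ δ

record Tee {o ℓ e} (𝒦 : Kripke o ℓ e) : Set (o ⊔ ℓ ⊔ e) where
  open Kripke 𝒦
  field
    ε : ∀ {A} → F₀ A ⇒ A
    ε-natural : ∀ {A B} {f : A ⇒ B} → f ∘ ε ≈ ε ∘ F₁ f
    ε-monoidal : ∀ {A B} → ε {A × B} ∘ m ≈ ε ⁂ ε
    ε-monoidal₀ : ε ∘ m₀ ≈ id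

record BdP {o ℓ e} (𝒦 : Kripke o ℓ e) : Set (o ⊔ ℓ ⊔ e) where
  open Kripke 𝒦
  field
    ε : ∀ {A} → F₀ A ⇒ A
    ε-natural : ∀ {A B} {f : A ⇒ B} → f ∘ ε ≈ ε ∘ F₁ f
    ε-monoidal : ∀ {A B} → ε {A × B} ∘ m ≈ ε ⁂ ε
    ε-monoidal₀ : ε ∘ m₀ ≈ id
    δ : ∀ {A} → F₀ A ⇒ F₀ (F₀ A)
    δ-natural : ∀ {A B} {f : A ⇒ B} → F₁ (F₁ f) ∘ δ ≈ δ ∘ F₁ f
    δ-monoidal : ∀ {A B} → δ {A × B} ∘ m ≈ F₁ m ∘ m ∘ (δ ⁂ δ)
    δ-monoidal₀ : δ ∘ m₀ ≈ F₁ m₀ ∘ m₀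
    comonad-idˡ : ∀ {A} → ε {F₀ A} ∘ δ ≈ id
    comonad-idʳ : ∀ {A} → F₁ (ε {A}) ∘ δ ≈ id
    comonad-assoc : ∀ {A} → δ {F₀ A} ∘ δ {A} ≈ F₁ δ ∘ δ

record NoExtra {o ℓ e} (𝒦 : Kripke o ℓ e) : Set (o ⊔ ℓ ⊔ e) where

Extra : ∀ {o ℓ e} → Logic → Kripke o ℓ e → Set (o ⊔ ℓ ⊔ e)
Extra LK  𝒦 = NoExtra 𝒦
Extra LK4 𝒦 = Four 𝒦
Extra LT  𝒦 = Tee 𝒦
Extra LS4 𝒦 = BdP 𝒦

module Semantics {o ℓ e} (L : Logic) (𝒦 : Kripke o ℓ e) (X : Extra L 𝒦)
                 (I : ℕ → Kripke.Obj 𝒦) where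
  open Kripke 𝒦

  ⟦_⟧ᵀ : Ty → Obj
  ⟦ base i ⟧ᵀ = I i
  ⟦ A ×ᵗ B ⟧ᵀ = ⟦ A ⟧ᵀ × ⟦ B ⟧ᵀ
  ⟦ A ⇒ᵗ B ⟧ᵀ = ⟦ B ⟧ᵀ ^ ⟦ A ⟧ᵀ
  ⟦ □ A ⟧ᵀ    = F₀ ⟦ A ⟧ᵀ

  os : Ctx → SL Obj
  os = mapSL ⟦_⟧ᵀ

  ext : Obj → SL Obj → Obj
  ext P []       = P
  ext P (xs ▸ x) = ext P xs × x

  Π : SL Obj → Obj
  Π = ext 𝟙

  mapF : SL Obj → SL Obj
  mapF = mapSL F₀

  ⟦_⨾_⟧ : Ctx → Ctx → Obj
  ⟦ Δ ⨾ Γ ⟧ = ext (Π (mapF (os Δ))) (os Γ)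

  mⁿ : (xs : SL Obj) → Π (mapF xs) ⇒ F₀ (Π xs)
  mⁿ []       = m₀
  mⁿ (xs ▸ x) = m ∘ (mⁿ xs ⁂ id)

  mExt : (xs ys : SL Obj) → ext (Π (mapF xs)) (mapF ys) ⇒ F₀ (ext (Π xs) ys)
  mExt xs []       = mⁿ xs
  mExt xs (ys ▸ y) = m ∘ (mExt xs ys ⁂ id)

  into : ∀ {Y P} (ys : SL Obj) → Y ⇒ P → Y ⇒ Π ys → Y ⇒ ext P ys
  into []       a b = a
  into (ys ▸ y) a b = ⟨ into ys a (π₁ ∘ b) , π₂ ∘ b ⟩

  drop : ∀ {P} (ys : SL Obj) → ext P ys ⇒ P
  drop []       = id
  drop (ys ▸ y) = drop ys ∘ π₁

  iproj : ∀ {P Γ A} → Γ ∋ A → ext P (os Γ) ⇒ ⟦ A ⟧ᵀ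
  iproj here      = π₂
  iproj (there x) = iproj x ∘ π₁

  mproj : ∀ {Δ A} → Δ ∋ A → Π (mapF (os Δ)) ⇒ F₀ ⟦ A ⟧ᵀ
  mproj here      = π₂
  mproj (there u) = mproj u ∘ π₁

  ins : ∀ {Y P Q} (ys : SL Obj) → Y ⇒ ext P ys → Y ⇒ Q → Y ⇒ ext (P × Q) ys
  ins []       r g = ⟨ r , g ⟩
  ins (ys ▸ y) r g = ⟨ ins ys (π₁ ∘ r) g , π₂ ∘ r ⟩

  δs : (δ : ∀ {A} → F₀ A ⇒ F₀ (F₀ A)) → (xs : SL Obj) → Π (mapF xs) ⇒ Π (mapF (mapF xs))
  δs δ []       = id
  δs δ (xs ▸ x) = δs δ xs ⁂ δ

  boxSem : ∀ L' → Extra L' 𝒦 → ∀ Δ {A} → ⟦ BΔ L' Δ ⨾ BΓ L' Δ ⟧ ⇒ ⟦ A ⟧ᵀ →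
           ⟦ Δ ⨾ [] ⟧ ⇒ F₀ ⟦ A ⟧ᵀ
  boxSem LK  X' Δ f = F₁ f ∘ mⁿ (os Δ)
  boxSem LT  X' Δ f = F₁ f ∘ mⁿ (os Δ)
  boxSem LK4 X' Δ f = F₁ f ∘ (mExt (mapF (os Δ)) (os Δ)
                             ∘ into (mapF (os Δ)) (δs (Four.δ X') (os Δ)) id)
  boxSem LS4 X' Δ f = F₁ f ∘ (mⁿ (mapF (os Δ)) ∘ δs (BdP.δ X') (os Δ))

  mvarSem : ∀ L' → Extra L' 𝒦 → HasMVar L' → ∀ {Δ A} → Δ ∋ A →
            ⟦ Δ ⨾ [] ⟧ ⇒ ⟦ A ⟧ᵀ
  mvarSem LT  X' h u = Tee.ε X' ∘ mproj u
  mvarSem LS4 X' h u = BdP.ε X' ∘ mproj u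

  ⟦_⟧ : ∀ {Δ Γ A} → Tm L Δ Γ A → ⟦ Δ ⨾ Γ ⟧ ⇒ ⟦ A ⟧ᵀ
  ⟦ var x ⟧ = iproj x
  ⟦_⟧ {Γ = Γ} (mvar h u) = mvarSem L X h u ∘ drop (os Γ)
  ⟦ lam M ⟧ = curry ⟦ M ⟧
  ⟦ app M N ⟧ = eval ∘ ⟨ ⟦ M ⟧ , ⟦ N ⟧ ⟩
  ⟦ pair M N ⟧ = ⟨ ⟦ M ⟧ , ⟦ N ⟧ ⟩
  ⟦ prj₁ M ⟧ = π₁ ∘ ⟦ M ⟧
  ⟦ prj₂ M ⟧ = π₂ ∘ ⟦ M ⟧
  ⟦_⟧ {Δ} {Γ} (box {A = A} M) = boxSem L X Δ {A} ⟦ M ⟧ ∘ drop (os Γ)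
  ⟦_⟧ {Γ = Γ} (letbox {A = A} M N) = ⟦ N ⟧ ∘ ins {Q = F₀ ⟦ A ⟧ᵀ} (os Γ) id ⟦ M ⟧

module Submission where

-- Congruences and the
-- η-rules are direct; the β-rules rest on substitution lemmas saying that
-- renaming, intuitionistic substitution and modal substitution act on
-- denotations by precomposition with maps between context objects.

open import Defs
open import Level using (Level; _⊔_)
open import Data.Nat using (ℕ)
open import Data.Unit using (tt)
open import Relation.Binary using (IsEquivalence; Setoid)
import Relation.Binary.Reasoning.Setoid as SetoidReasoning
import Relation.Binary.PropositionalEquality as ≡

module CCCLemmas {o ℓ e} (𝒞 : CCC o ℓ e) where
  open CCC 𝒞
  open CCCOps 𝒞

  module Equiv {A B : Obj} = IsEquivalence (≈-equiv {A} {B})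
  open Equiv public using (refl; sym; trans)

  hom-setoid : Obj → Obj → Setoid ℓ e
  hom-setoid A B = record { Carrier = A ⇒ B ; _≈_ = _≈_ ; isEquivalence = ≈-equiv }

  module HomReasoning {A B : Obj} = SetoidReasoning (hom-setoid A B)
  open HomReasoning public

  infixr 4 refl⟩∘⟨_
  infixl 5 _⟩∘⟨refl

  refl⟩∘⟨_ : ∀ {A B C} {f : B ⇒ C} {g h : A ⇒ B} → g ≈ h → f ∘ g ≈ f ∘ h
  refl⟩∘⟨ p = ∘-resp-≈ refl p

  _⟩∘⟨refl : ∀ {A B C} {f g : B ⇒ C} {h : A ⇒ B} → f ≈ g → f ∘ h ≈ g ∘ h
  p ⟩∘⟨refl = ∘-resp-≈ p refl

  sym-assoc : ∀ {A B C D} {f : A ⇒ B} {g : B ⇒ C} {h : C ⇒ D} → h ∘ (g ∘ f) ≈ (h ∘ g) ∘ f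
  sym-assoc = sym assoc

  pullˡ : ∀ {A B C D} {a : C ⇒ D} {b : B ⇒ C} {c : B ⇒ D} {f : A ⇒ B} →
          a ∘ b ≈ c → a ∘ (b ∘ f) ≈ c ∘ f
  pullˡ p = trans sym-assoc (p ⟩∘⟨refl)

  pushˡ : ∀ {A B C D} {a : C ⇒ D} {b : B ⇒ C} {c : B ⇒ D} {f : A ⇒ B} →
          c ≈ a ∘ b → c ∘ f ≈ a ∘ (b ∘ f)
  pushˡ p = trans (p ⟩∘⟨refl) assoc

  factor-cong : ∀ {A B C D} {a : C ⇒ D} {s : B ⇒ C} {b : B ⇒ D} {f g : A ⇒ B} →
                a ∘ s ≈ b → b ∘ f ≈ b ∘ g → a ∘ (s ∘ f) ≈ a ∘ (s ∘ g)
  factor-cong r t = trans (pullˡ r) (trans t (sym (pullˡ r)))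

  split-mono-cancel : ∀ {A B C} {r : C ⇒ B} {s : B ⇒ C} {f g : A ⇒ B} →
                      r ∘ s ≈ id → s ∘ f ≈ s ∘ g → f ≈ g
  split-mono-cancel {r = r} {s} {f} {g} rs≈id p = begin
    f             ≈⟨ identityˡ ⟨
    id ∘ f        ≈⟨ rs≈id ⟩∘⟨refl ⟨
    (r ∘ s) ∘ f   ≈⟨ assoc ⟩
    r ∘ (s ∘ f)   ≈⟨ refl⟩∘⟨ p ⟩
    r ∘ (s ∘ g)   ≈⟨ pullˡ rs≈id ⟩
    id ∘ g        ≈⟨ identityˡ ⟩
    g             ∎

  ⟨⟩∘ : ∀ {A B C D} {f : C ⇒ A} {g : C ⇒ B} {h : D ⇒ C} → ⟨ f , g ⟩ ∘ h ≈ ⟨ f ∘ h , g ∘ h ⟩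
  ⟨⟩∘ = ⟨⟩-unique (pullˡ project₁) (pullˡ project₂)

  ⟨⟩-cong : ∀ {A B C} {f f' : C ⇒ A} {g g' : C ⇒ B} → f ≈ f' → g ≈ g' → ⟨ f , g ⟩ ≈ ⟨ f' , g' ⟩
  ⟨⟩-cong p q = ⟨⟩-unique (trans project₁ p) (trans project₂ q)

  project₁-∘ : ∀ {A B C D} {a : A ⇒ D} {f : C ⇒ A} {g : C ⇒ B} → (a ∘ π₁) ∘ ⟨ f , g ⟩ ≈ a ∘ f
  project₁-∘ = trans assoc (refl⟩∘⟨ project₁)

  ×-ext : ∀ {A B C} {f g : C ⇒ A × B} → π₁ ∘ f ≈ π₁ ∘ g → π₂ ∘ f ≈ π₂ ∘ g → f ≈ g
  ×-ext p q = trans (⟨⟩-unique p q) (sym (⟨⟩-unique refl refl))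

  𝟙-ext : ∀ {A} (f g : A ⇒ 𝟙) → f ≈ g
  𝟙-ext f g = trans (!-unique f) (sym (!-unique g))

  ⁂∘⁂ : ∀ {A B C D E G} {f : B ⇒ C} {g : E ⇒ G} {h : A ⇒ B} {k : D ⇒ E} →
        (f ⁂ g) ∘ (h ⁂ k) ≈ (f ∘ h) ⁂ (g ∘ k)
  ⁂∘⁂ = ×-ext (trans (pullˡ project₁) (trans assoc (trans (refl⟩∘⟨ project₁) (trans sym-assoc (sym project₁)))))
              (trans (pullˡ project₂) (trans assoc (trans (refl⟩∘⟨ project₂) (trans sym-assoc (sym project₂)))))

  ⁂∘⟨⟩ : ∀ {A B C D E} {f : A ⇒ B} {g : C ⇒ D} {p : E ⇒ A} {q : E ⇒ C} →
          (f ⁂ g) ∘ ⟨ p , q ⟩ ≈ ⟨ f ∘ p , g ∘ q ⟩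
  ⁂∘⟨⟩ = trans ⟨⟩∘ (⟨⟩-cong project₁-∘ (trans assoc (refl⟩∘⟨ project₂)))

  ⁂-cong : ∀ {A B C D} {f f' : A ⇒ B} {g g' : C ⇒ D} → f ≈ f' → g ≈ g' → f ⁂ g ≈ f' ⁂ g'
  ⁂-cong p q = ⟨⟩-cong (p ⟩∘⟨refl) (q ⟩∘⟨refl)

  curry-cong : ∀ {A B C} {f g : C × A ⇒ B} → f ≈ g → curry f ≈ curry g
  curry-cong p = curry-unique (trans curry-β p)

  curry-∘ : ∀ {A B C D} {f : C × A ⇒ B} {h : D ⇒ C} → curry f ∘ h ≈ curry (f ∘ (h ⁂ id))
  curry-∘ {f = f} {h} = curry-unique (begin
    eval ∘ ⟨ (curry f ∘ h) ∘ π₁ , id ∘ π₂ ⟩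
      ≈⟨ refl⟩∘⟨ ⟨⟩-cong (trans assoc (trans (refl⟩∘⟨ sym project₁) sym-assoc))
                         (sym (trans assoc (trans identityˡ project₂))) ⟩
    eval ∘ ⟨ (curry f ∘ π₁) ∘ (h ⁂ id) , (id ∘ π₂) ∘ (h ⁂ id) ⟩
      ≈⟨ refl⟩∘⟨ ⟨⟩∘ ⟨
    eval ∘ (⟨ curry f ∘ π₁ , id ∘ π₂ ⟩ ∘ (h ⁂ id))
      ≈⟨ pullˡ curry-β ⟩
    f ∘ (h ⁂ id) ∎)

  curry-η : ∀ {A B C} {h : C ⇒ B ^ A} → curry (eval ∘ ⟨ h ∘ π₁ , π₂ ⟩) ≈ h
  curry-η = sym (curry-unique (refl⟩∘⟨ ⟨⟩-cong refl identityˡ))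

  eval-curry : ∀ {A B C} {f : C × A ⇒ B} {g : C ⇒ A} → eval ∘ ⟨ curry f , g ⟩ ≈ f ∘ ⟨ id , g ⟩
  eval-curry {f = f} {g} = begin
    eval ∘ ⟨ curry f , g ⟩
      ≈⟨ refl⟩∘⟨ ⟨⟩-cong (trans (refl⟩∘⟨ project₁) identityʳ) (trans (refl⟩∘⟨ project₂) identityˡ) ⟨
    eval ∘ ⟨ curry f ∘ (π₁ ∘ ⟨ id , g ⟩) , id ∘ (π₂ ∘ ⟨ id , g ⟩) ⟩
      ≈⟨ refl⟩∘⟨ trans ⟨⟩∘ (⟨⟩-cong assoc assoc) ⟨
    eval ∘ (⟨ curry f ∘ π₁ , id ∘ π₂ ⟩ ∘ ⟨ id , g ⟩)
      ≈⟨ pullˡ curry-β ⟩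
    f ∘ ⟨ id , g ⟩ ∎

-- Consequences of F being strong monoidal: F preserves the product
-- projections up to m, so maps into F (A × B) and F (F (A × B)) are
-- determined by their images under F π₁ and F π₂, and F 𝟙 is terminal.
module KripkeLemmas {o ℓ e} (𝒦 : Kripke o ℓ e) where
  open Kripke 𝒦
  open CCCLemmas ccc

  F-compose : ∀ {A B C} {f : A ⇒ B} {g : B ⇒ C} {h : A ⇒ C} → g ∘ f ≈ h → F₁ g ∘ F₁ f ≈ F₁ h
  F-compose p = trans (sym F-∘) (F-resp-≈ p)

  F𝟙-ext : ∀ {A} (f g : A ⇒ F₀ 𝟙) → f ≈ g
  F𝟙-ext f g = split-mono-cancel m₀-isoʳ (𝟙-ext _ _)

  Fπ₂∘m : ∀ {A B} → F₁ π₂ ∘ m {A} {B} ≈ π₂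
  Fπ₂∘m = begin
    F₁ π₂ ∘ m                              ≈⟨ F-resp-≈ π₂≈ ⟩∘⟨refl ⟩
    F₁ (π₂ ∘ (! ⁂ id)) ∘ m                 ≈⟨ pushˡ F-∘ ⟩
    F₁ π₂ ∘ (F₁ (! ⁂ id) ∘ m)              ≈⟨ refl⟩∘⟨ m-natural ⟨
    F₁ π₂ ∘ (m ∘ (F₁ ! ⁂ F₁ id))           ≈⟨ refl⟩∘⟨ refl⟩∘⟨ F!⁂Fid ⟩
    F₁ π₂ ∘ (m ∘ ((m₀ ⁂ id) ∘ (! ⁂ id)))   ≈⟨ trans (refl⟩∘⟨ sym-assoc) sym-assoc ⟩
    (F₁ π₂ ∘ (m ∘ (m₀ ⁂ id))) ∘ (! ⁂ id)   ≈⟨ m-unitˡ ⟩∘⟨refl ⟩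
    π₂ ∘ (! ⁂ id)                          ≈⟨ π₂≈ ⟨
    π₂                                     ∎
    where
      π₂≈ : ∀ {X Y} → π₂ {X} {Y} ≈ π₂ ∘ (! ⁂ id)
      π₂≈ = sym (trans project₂ identityˡ)
      F!⁂Fid : ∀ {X Y} → F₁ (! {X}) ⁂ F₁ (id {Y}) ≈ (m₀ ⁂ id) ∘ (! ⁂ id)
      F!⁂Fid = trans (⁂-cong (F𝟙-ext _ _) (trans F-id (sym identityˡ))) (sym ⁂∘⁂)

  Fπ₁∘m : ∀ {A B} → F₁ π₁ ∘ m {A} {B} ≈ π₁
  Fπ₁∘m = begin
    F₁ π₁ ∘ m                              ≈⟨ F-resp-≈ π₁≈ ⟩∘⟨refl ⟩
    F₁ (π₁ ∘ (id ⁂ !)) ∘ m                 ≈⟨ pushˡ F-∘ ⟩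
    F₁ π₁ ∘ (F₁ (id ⁂ !) ∘ m)              ≈⟨ refl⟩∘⟨ m-natural ⟨
    F₁ π₁ ∘ (m ∘ (F₁ id ⁂ F₁ !))           ≈⟨ refl⟩∘⟨ refl⟩∘⟨ Fid⁂F! ⟩
    F₁ π₁ ∘ (m ∘ ((id ⁂ m₀) ∘ (id ⁂ !)))   ≈⟨ trans (refl⟩∘⟨ sym-assoc) sym-assoc ⟩
    (F₁ π₁ ∘ (m ∘ (id ⁂ m₀))) ∘ (id ⁂ !)   ≈⟨ m-unitʳ ⟩∘⟨refl ⟩
    π₁ ∘ (id ⁂ !)                          ≈⟨ π₁≈ ⟨
    π₁                                     ∎
    where
      π₁≈ : ∀ {X Y} → π₁ {X} {Y} ≈ π₁ ∘ (id ⁂ !)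
      π₁≈ = sym (trans project₁ identityˡ)
      Fid⁂F! : ∀ {X Y} → F₁ (id {X}) ⁂ F₁ (! {Y}) ≈ (id ⁂ m₀) ∘ (id ⁂ !)
      Fid⁂F! = trans (⁂-cong (trans F-id (sym identityˡ)) (F𝟙-ext _ _)) (sym ⁂∘⁂)

  π₁∘m⁻¹ : ∀ {A B} → π₁ ∘ m⁻¹ {A} {B} ≈ F₁ π₁
  π₁∘m⁻¹ = trans (sym Fπ₁∘m ⟩∘⟨refl) (trans assoc (trans (refl⟩∘⟨ m-isoʳ) identityʳ))

  π₂∘m⁻¹ : ∀ {A B} → π₂ ∘ m⁻¹ {A} {B} ≈ F₁ π₂
  π₂∘m⁻¹ = trans (sym Fπ₂∘m ⟩∘⟨refl) (trans assoc (trans (refl⟩∘⟨ m-isoʳ) identityʳ))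

  F×-ext : ∀ {A B Y} {f g : Y ⇒ F₀ (A × B)} →
           F₁ π₁ ∘ f ≈ F₁ π₁ ∘ g → F₁ π₂ ∘ f ≈ F₁ π₂ ∘ g → f ≈ g
  F×-ext p q = split-mono-cancel m-isoʳ (×-ext (factor-cong π₁∘m⁻¹ p) (factor-cong π₂∘m⁻¹ q))

  Fπ₁∘m∘⟨⟩ : ∀ {A C D} {f : A ⇒ F₀ C} {g : A ⇒ F₀ D} → F₁ π₁ ∘ (m ∘ ⟨ f , g ⟩) ≈ f
  Fπ₁∘m∘⟨⟩ = trans (pullˡ Fπ₁∘m) project₁

  Fπ₂∘m∘⟨⟩ : ∀ {A C D} {f : A ⇒ F₀ C} {g : A ⇒ F₀ D} → F₁ π₂ ∘ (m ∘ ⟨ f , g ⟩) ≈ g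
  Fπ₂∘m∘⟨⟩ = trans (pullˡ Fπ₂∘m) project₂

  FF𝟙-ext : ∀ {A} (f g : A ⇒ F₀ (F₀ 𝟙)) → f ≈ g
  FF𝟙-ext f g = split-mono-cancel (trans (F-compose m₀-isoʳ) F-id) (F𝟙-ext _ _)

  FF×-ext : ∀ {A B Y} {f g : Y ⇒ F₀ (F₀ (A × B))} →
            F₁ (F₁ π₁) ∘ f ≈ F₁ (F₁ π₁) ∘ g → F₁ (F₁ π₂) ∘ f ≈ F₁ (F₁ π₂) ∘ g → f ≈ g
  FF×-ext p q = split-mono-cancel (trans (F-compose m-isoʳ) F-id)
    (F×-ext (factor-cong (F-compose π₁∘m⁻¹) p) (factor-cong (F-compose π₂∘m⁻¹) q))

  -- Maps into G ⟦Δ;Γ⟧ are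
  -- then determined by their components; this is needed for G = Id, F, F ∘ F.
  record ProductDetecting : Set (o ⊔ ℓ ⊔ e) where
    field
      G₀ : Obj → Obj
      G₁ : ∀ {A B} → A ⇒ B → G₀ A ⇒ G₀ B
      G-∘ : ∀ {A B C} {f : A ⇒ B} {g : B ⇒ C} → G₁ (g ∘ f) ≈ G₁ g ∘ G₁ f
      G-resp-≈ : ∀ {A B} {f g : A ⇒ B} → f ≈ g → G₁ f ≈ G₁ g
      G×-ext : ∀ {A B Y} {f g : Y ⇒ G₀ (A × B)} →
               G₁ π₁ ∘ f ≈ G₁ π₁ ∘ g → G₁ π₂ ∘ f ≈ G₁ π₂ ∘ g → f ≈ g
      G𝟙-ext : ∀ {Y} (f g : Y ⇒ G₀ 𝟙) → f ≈ g

  Id-detecting : ProductDetecting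
  Id-detecting = record
    { G₀ = λ A → A ; G₁ = λ f → f ; G-∘ = refl ; G-resp-≈ = λ p → p
    ; G×-ext = ×-ext ; G𝟙-ext = 𝟙-ext }

  F-detecting : ProductDetecting
  F-detecting = record
    { G₀ = F₀ ; G₁ = F₁ ; G-∘ = F-∘ ; G-resp-≈ = F-resp-≈
    ; G×-ext = F×-ext ; G𝟙-ext = F𝟙-ext }

  FF-detecting : ProductDetecting
  FF-detecting = record
    { G₀ = λ A → F₀ (F₀ A) ; G₁ = λ f → F₁ (F₁ f)
    ; G-∘ = trans (F-resp-≈ F-∘) F-∘
    ; G-resp-≈ = λ p → F-resp-≈ (F-resp-≈ p) ; G×-ext = FF×-ext ; G𝟙-ext = FF𝟙-ext }

module Model {o ℓ e} (𝒦 : Kripke o ℓ e) (I : ℕ → Kripke.Obj 𝒦)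
             (L : Logic) (X : Extra L 𝒦) where
  open Kripke 𝒦
  open CCCLemmas ccc
  open KripkeLemmas 𝒦
  open Semantics L 𝒦 X I public

  module Extensionality (G : ProductDetecting) where
    open ProductDetecting G

    private
      resp : ∀ {Y P R} {a b : P ⇒ R} {f g : Y ⇒ G₀ P} →
             a ≈ b → G₁ a ∘ f ≈ G₁ a ∘ g → G₁ b ∘ f ≈ G₁ b ∘ g
      resp a≈b p = trans (sym (G-resp-≈ a≈b) ⟩∘⟨refl) (trans p (G-resp-≈ a≈b ⟩∘⟨refl))

      through-π₁ : ∀ {Y P Q R} {k : P ⇒ R} {f g : Y ⇒ G₀ (P × Q)} →
                   G₁ (k ∘ π₁) ∘ f ≈ G₁ (k ∘ π₁) ∘ g →
                   G₁ k ∘ (G₁ π₁ ∘ f) ≈ G₁ k ∘ (G₁ π₁ ∘ g)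
      through-π₁ = factor-cong (sym G-∘)

    modal-ext : ∀ Δ {Y} {f g : Y ⇒ G₀ ⟦ Δ ⨾ [] ⟧} →
                (∀ {A} (u : Δ ∋ A) → G₁ (mproj u) ∘ f ≈ G₁ (mproj u) ∘ g) → f ≈ g
    modal-ext []      h = G𝟙-ext _ _
    modal-ext (Δ ▸ A) h = G×-ext (modal-ext Δ (λ u → through-π₁ (h (there u)))) (h here)

    ctx-ext : ∀ Δ Γ {Y} {f g : Y ⇒ G₀ ⟦ Δ ⨾ Γ ⟧} →
              (∀ {A} (u : Δ ∋ A) → G₁ (mproj u ∘ drop (os Γ)) ∘ f ≈ G₁ (mproj u ∘ drop (os Γ)) ∘ g) →
              (∀ {A} (x : Γ ∋ A) → G₁ (iproj x) ∘ f ≈ G₁ (iproj x) ∘ g) → f ≈ g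
    ctx-ext Δ []      hm hi = modal-ext Δ (λ u → resp identityʳ (hm u))
    ctx-ext Δ (Γ ▸ A) hm hi =
      G×-ext (ctx-ext Δ Γ (λ u → through-π₁ (resp sym-assoc (hm u))) (λ x → through-π₁ (hi (there x))))
             (hi here)

  module IdExt = Extensionality Id-detecting
  module FExt  = Extensionality F-detecting
  module FFExt = Extensionality FF-detecting

  env : ∀ {Y P} Γ → Y ⇒ P → (∀ {A} → Γ ∋ A → Y ⇒ ⟦ A ⟧ᵀ) → Y ⇒ ext P (os Γ)
  env []      p f = p
  env (Γ ▸ A) p f = ⟨ env Γ p (λ x → f (there x)) , f here ⟩

  menv : ∀ {Y} Δ → (∀ {A} → Δ ∋ A → Y ⇒ F₀ ⟦ A ⟧ᵀ) → Y ⇒ ⟦ Δ ⨾ [] ⟧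
  menv []      f = !
  menv (Δ ▸ A) f = ⟨ menv Δ (λ u → f (there u)) , f here ⟩

  iproj∘env : ∀ {Y P Γ A} {p : Y ⇒ P} {f : ∀ {B} → Γ ∋ B → Y ⇒ ⟦ B ⟧ᵀ} (x : Γ ∋ A) →
              iproj x ∘ env Γ p f ≈ f x
  iproj∘env here      = project₂
  iproj∘env (there x) = trans project₁-∘ (iproj∘env x)

  drop∘env : ∀ {Y P} Γ {p : Y ⇒ P} {f : ∀ {B} → Γ ∋ B → Y ⇒ ⟦ B ⟧ᵀ} → drop (os Γ) ∘ env Γ p f ≈ p
  drop∘env []      = identityˡ
  drop∘env (Γ ▸ A) = trans project₁-∘ (drop∘env Γ)

  mproj∘drop∘env : ∀ {Y Δ Γ A} {p : Y ⇒ ⟦ Δ ⨾ [] ⟧} {f : ∀ {B} → Γ ∋ B → Y ⇒ ⟦ B ⟧ᵀ} (u : Δ ∋ A) →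
                   (mproj u ∘ drop (os Γ)) ∘ env Γ p f ≈ mproj u ∘ p
  mproj∘drop∘env {Γ = Γ} u = trans assoc (refl⟩∘⟨ drop∘env Γ)

  mproj∘menv : ∀ {Y Δ A} {f : ∀ {B} → Δ ∋ B → Y ⇒ F₀ ⟦ B ⟧ᵀ} (u : Δ ∋ A) → mproj u ∘ menv Δ f ≈ f u
  mproj∘menv here      = project₂
  mproj∘menv (there u) = trans project₁-∘ (mproj∘menv u)

  env-∘ : ∀ {Y Z P} Γ {p : Y ⇒ P} {f : ∀ {B} → Γ ∋ B → Y ⇒ ⟦ B ⟧ᵀ} {h : Z ⇒ Y} →
          env Γ p f ∘ h ≈ env Γ (p ∘ h) (λ x → f x ∘ h)
  env-∘ []      = refl
  env-∘ (Γ ▸ A) = trans ⟨⟩∘ (⟨⟩-cong (env-∘ Γ) refl)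

  env-cong : ∀ {Y P} Γ {p p' : Y ⇒ P} {f f' : ∀ {B} → Γ ∋ B → Y ⇒ ⟦ B ⟧ᵀ} →
             p ≈ p' → (∀ {B} (x : Γ ∋ B) → f x ≈ f' x) → env Γ p f ≈ env Γ p' f'
  env-cong []      p q = p
  env-cong (Γ ▸ A) p q = ⟨⟩-cong (env-cong Γ p (λ x → q (there x))) (q here)

  -- ins ys r g inserts the component g between the modal and the intuitionistic
  -- part of r; it interprets the binding of a new modal variable by let box.
  iproj∘ins : ∀ {Y P Q Γ A} {r : Y ⇒ ext P (os Γ)} {g : Y ⇒ Q} (x : Γ ∋ A) →
              iproj x ∘ ins (os Γ) r g ≈ iproj x ∘ r
  iproj∘ins here      = project₂
  iproj∘ins (there x) = trans project₁-∘ (trans (iproj∘ins x) sym-assoc)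

  drop∘ins : ∀ {Y P Q} ys {r : Y ⇒ ext P ys} {g : Y ⇒ Q} → drop ys ∘ ins ys r g ≈ ⟨ drop ys ∘ r , g ⟩
  drop∘ins []       = trans identityˡ (⟨⟩-cong (sym identityˡ) refl)
  drop∘ins (ys ▸ y) = trans project₁-∘ (trans (drop∘ins ys) (⟨⟩-cong sym-assoc refl))

  ins-cong : ∀ {Y P Q} ys {r : Y ⇒ ext P ys} {g g' : Y ⇒ Q} → g ≈ g' → ins ys r g ≈ ins ys r g'
  ins-cong []       p = ⟨⟩-cong refl p
  ins-cong (ys ▸ y) p = ⟨⟩-cong (ins-cong ys p) refl

  top∘ins : ∀ {Y Δ Γ A} {r : Y ⇒ ⟦ Δ ⨾ Γ ⟧} {g : Y ⇒ F₀ ⟦ A ⟧ᵀ} →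
            (mproj {Δ ▸ A} here ∘ drop (os Γ)) ∘ ins (os Γ) r g ≈ g
  top∘ins {Γ = Γ} = trans assoc (trans (refl⟩∘⟨ drop∘ins (os Γ)) project₂)

  pop∘ins : ∀ {Y Δ Γ A B} {r : Y ⇒ ⟦ Δ ⨾ Γ ⟧} {g : Y ⇒ F₀ ⟦ A ⟧ᵀ} (u : Δ ∋ B) →
            (mproj {Δ ▸ A} (there u) ∘ drop (os Γ)) ∘ ins (os Γ) r g ≈ (mproj u ∘ drop (os Γ)) ∘ r
  pop∘ins {Γ = Γ} u = trans assoc (trans (refl⟩∘⟨ drop∘ins (os Γ)) (trans project₁-∘ sym-assoc))

  -- Renamings and substitutions act on denotations by precomposition with
  -- the following maps between context objects.
  ⟦mren⟧ : ∀ {Δ Δ'} → Ren Δ Δ' → ⟦ Δ' ⨾ [] ⟧ ⇒ ⟦ Δ ⨾ [] ⟧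
  ⟦mren⟧ {Δ} ρ = menv Δ (λ u → mproj (ρ u))

  ⟦ren⟧ : ∀ {Δ Δ' Γ Γ'} → Ren Δ Δ' → Ren Γ Γ' → ⟦ Δ' ⨾ Γ' ⟧ ⇒ ⟦ Δ ⨾ Γ ⟧
  ⟦ren⟧ {Γ = Γ} {Γ'} ρ σ = env Γ (⟦mren⟧ ρ ∘ drop (os Γ')) (λ x → iproj (σ x))

  ⟦sub⟧ : ∀ {Δ Δ' Γ Γ'} → Ren Δ Δ' → Sub L Δ' Γ Γ' → ⟦ Δ' ⨾ Γ' ⟧ ⇒ ⟦ Δ ⨾ Γ ⟧
  ⟦sub⟧ {Γ = Γ} {Γ'} ρ σ = env Γ (⟦mren⟧ ρ ∘ drop (os Γ')) (λ x → ⟦ σ x ⟧)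

  ⟦msub⟧ᴹ : ∀ {Δ Δ'} → MSub L Δ Δ' → ⟦ Δ' ⨾ [] ⟧ ⇒ ⟦ Δ ⨾ [] ⟧
  ⟦msub⟧ᴹ {Δ} {Δ'} σ = menv Δ (λ {B} u → boxSem L X Δ' {B} ⟦ σ u ⟧)

  ⟦msub⟧ : ∀ {Δ Δ' Γ} → MSub L Δ Δ' → ⟦ Δ' ⨾ Γ ⟧ ⇒ ⟦ Δ ⨾ Γ ⟧
  ⟦msub⟧ {Γ = Γ} σ = env Γ (⟦msub⟧ᴹ σ ∘ drop (os Γ)) iproj

  mproj∘⟦mren⟧ : ∀ {Δ Δ' A} (ρ : Ren Δ Δ') (u : Δ ∋ A) → mproj u ∘ ⟦mren⟧ ρ ≈ mproj (ρ u)
  mproj∘⟦mren⟧ ρ u = mproj∘menv u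

  mproj∘⟦msub⟧ᴹ : ∀ {Δ Δ' A} (σ : MSub L Δ Δ') (u : Δ ∋ A) →
                  mproj u ∘ ⟦msub⟧ᴹ σ ≈ boxSem L X Δ' {A} ⟦ σ u ⟧
  mproj∘⟦msub⟧ᴹ σ u = mproj∘menv u

  ⟦mren⟧-id : ∀ {Δ} → ⟦mren⟧ {Δ} (λ u → u) ≈ id
  ⟦mren⟧-id {Δ} = IdExt.modal-ext Δ (λ u → trans (mproj∘menv u) (sym identityʳ))

  ⟦mren⟧-there : ∀ {Δ A} → ⟦mren⟧ {Δ} {Δ ▸ A} there ≈ π₁
  ⟦mren⟧-there {Δ} = IdExt.modal-ext Δ mproj∘menv

  ⟦ren⟧-id : ∀ {Δ Γ} → ⟦ren⟧ {Δ} {Δ} {Γ} {Γ} (λ u → u) (λ x → x) ≈ id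
  ⟦ren⟧-id {Δ} {Γ} = IdExt.ctx-ext Δ Γ
    (λ u → trans (mproj∘drop∘env {Γ = Γ} u) (trans (pullˡ (mproj∘menv u)) (sym identityʳ)))
    (λ x → trans (iproj∘env x) (sym identityʳ))

  ⟦ren⟧-there : ∀ {Δ Γ A} → ⟦ren⟧ {Δ} {Δ} {Γ} {Γ ▸ A} (λ u → u) there ≈ π₁
  ⟦ren⟧-there {Δ} {Γ} = IdExt.ctx-ext Δ Γ
    (λ u → trans (mproj∘drop∘env {Γ = Γ} u) (trans (pullˡ (mproj∘menv u)) sym-assoc))
    iproj∘env

  ⟦ren⟧-mthere∘ins : ∀ {Δ Γ A} {h : ⟦ Δ ⨾ Γ ⟧ ⇒ F₀ ⟦ A ⟧ᵀ} →
                     ⟦ren⟧ {Δ} {Δ ▸ A} {Γ} {Γ} there (λ x → x) ∘ ins (os Γ) id h ≈ id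
  ⟦ren⟧-mthere∘ins {Δ} {Γ} {A} = IdExt.ctx-ext Δ Γ
    (λ u → trans sym-assoc (trans (trans (mproj∘drop∘env {Γ = Γ} u) (pullˡ (mproj∘menv u)) ⟩∘⟨refl)
                                  (pop∘ins {Γ = Γ} {A = A} u)))
    (λ x → trans sym-assoc (trans (iproj∘env x ⟩∘⟨refl) (iproj∘ins x)))

  app-∘ : ∀ {Y Z A B} {E : Y ⇒ Z} {a : Z ⇒ B ^ A} {b : Z ⇒ A} {a' b'} →
          a' ≈ a ∘ E → b' ≈ b ∘ E → eval ∘ ⟨ a' , b' ⟩ ≈ (eval ∘ ⟨ a , b ⟩) ∘ E
  app-∘ p q = trans (refl⟩∘⟨ trans (⟨⟩-cong p q) (sym ⟨⟩∘)) sym-assoc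

  pair-∘ : ∀ {Y Z A B} {E : Y ⇒ Z} {a : Z ⇒ A} {b : Z ⇒ B} {a' b'} →
           a' ≈ a ∘ E → b' ≈ b ∘ E → ⟨ a' , b' ⟩ ≈ ⟨ a , b ⟩ ∘ E
  pair-∘ p q = trans (⟨⟩-cong p q) (sym ⟨⟩∘)

  post-∘ : ∀ {Y Z A B} {E : Y ⇒ Z} {a : Z ⇒ A} {a' : Y ⇒ A} {p : A ⇒ B} →
           a' ≈ a ∘ E → p ∘ a' ≈ (p ∘ a) ∘ E
  post-∘ q = trans (refl⟩∘⟨ q) sym-assoc

  curry-∘′ : ∀ {Y Z A B} {E : Y ⇒ Z} {a : Z × A ⇒ B} {a' : Y × A ⇒ B} →
             a' ≈ a ∘ (E ⁂ id) → curry a' ≈ curry a ∘ E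
  curry-∘′ p = trans (curry-cong p) (sym curry-∘)

  letbox-∘ : ∀ {Δ Δ' Γ Γ' A C}
             {E : ⟦ Δ' ⨾ Γ' ⟧ ⇒ ⟦ Δ ⨾ Γ ⟧} {E' : ⟦ Δ' ▸ A ⨾ Γ' ⟧ ⇒ ⟦ Δ ▸ A ⨾ Γ ⟧}
             {n : ⟦ Δ ▸ A ⨾ Γ ⟧ ⇒ C} {n' : ⟦ Δ' ▸ A ⨾ Γ' ⟧ ⇒ C}
             {k : ⟦ Δ ⨾ Γ ⟧ ⇒ F₀ ⟦ A ⟧ᵀ} {k' : ⟦ Δ' ⨾ Γ' ⟧ ⇒ F₀ ⟦ A ⟧ᵀ} →
             n' ≈ n ∘ E' → k' ≈ k ∘ E → E' ∘ ins (os Γ') id (k ∘ E) ≈ ins (os Γ) id k ∘ E →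
             n' ∘ ins (os Γ') id k' ≈ (n ∘ ins (os Γ) id k) ∘ E
  letbox-∘ {Γ' = Γ'} p q r = trans (∘-resp-≈ p (ins-cong (os Γ') q)) (trans assoc (trans (refl⟩∘⟨ r) sym-assoc))

  modal-∘ : ∀ {Δ Δ' Γ Γ' B} {K : ⟦ Δ' ⨾ [] ⟧ ⇒ ⟦ Δ ⨾ [] ⟧}
            {f : ∀ {C} → Γ ∋ C → ⟦ Δ' ⨾ Γ' ⟧ ⇒ ⟦ C ⟧ᵀ}
            {a : ⟦ Δ ⨾ [] ⟧ ⇒ B} {a' : ⟦ Δ' ⨾ [] ⟧ ⇒ B} →
            a' ≈ a ∘ K → a' ∘ drop (os Γ') ≈ (a ∘ drop (os Γ)) ∘ env Γ (K ∘ drop (os Γ')) f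
  modal-∘ {Γ = Γ} p = trans (p ⟩∘⟨refl) (trans assoc (sym (trans assoc (refl⟩∘⟨ drop∘env Γ))))

  env-extend : ∀ {Δ Δ' Γ Γ' A} (K : ⟦ Δ' ⨾ [] ⟧ ⇒ ⟦ Δ ⨾ [] ⟧)
               {f : ∀ {B} → Γ ∋ B → ⟦ Δ' ⨾ Γ' ⟧ ⇒ ⟦ B ⟧ᵀ}
               {f' : ∀ {B} → (Γ ▸ A) ∋ B → ⟦ Δ' ⨾ Γ' ▸ A ⟧ ⇒ ⟦ B ⟧ᵀ} →
               f' here ≈ π₂ → (∀ {B} (x : Γ ∋ B) → f' (there x) ≈ f x ∘ π₁) →
               env (Γ ▸ A) (K ∘ drop (os (Γ' ▸ A))) f' ≈ env Γ (K ∘ drop (os Γ')) f ⁂ id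
  env-extend {Γ = Γ} K ph pt =
    ⟨⟩-cong (trans (env-cong Γ sym-assoc pt) (sym (env-∘ Γ))) (trans ph (sym identityˡ))

  env-letbox : ∀ {Δ Δ' Γ Γ' A}
               {K : ⟦ Δ' ⨾ [] ⟧ ⇒ ⟦ Δ ⨾ [] ⟧} {K' : ⟦ Δ' ▸ A ⨾ [] ⟧ ⇒ ⟦ Δ ▸ A ⨾ [] ⟧}
               {f : ∀ {B} → Γ ∋ B → ⟦ Δ' ⨾ Γ' ⟧ ⇒ ⟦ B ⟧ᵀ}
               {f' : ∀ {B} → Γ ∋ B → ⟦ Δ' ▸ A ⨾ Γ' ⟧ ⇒ ⟦ B ⟧ᵀ}
               {g : ⟦ Δ ⨾ Γ ⟧ ⇒ F₀ ⟦ A ⟧ᵀ} →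
               mproj {Δ ▸ A} here ∘ K' ≈ π₂ →
               (∀ {B} (u : Δ ∋ B) → mproj {Δ ▸ A} (there u) ∘ K' ≈ (mproj u ∘ K) ∘ π₁) →
               (∀ {h : ⟦ Δ' ⨾ Γ' ⟧ ⇒ F₀ ⟦ A ⟧ᵀ} {B} (x : Γ ∋ B) → f' x ∘ ins (os Γ') id h ≈ f x) →
               env Γ (K' ∘ drop (os Γ')) f' ∘ ins (os Γ') id (g ∘ env Γ (K ∘ drop (os Γ')) f)
                 ≈ ins (os Γ) id g ∘ env Γ (K ∘ drop (os Γ')) f
  env-letbox {Δ} {Δ'} {Γ} {Γ'} {A} {K} {K'} {f} {f'} {g} top pop ff = IdExt.ctx-ext (Δ ▸ A) Γ modal intuitionistic
    where
      E : ⟦ Δ' ⨾ Γ' ⟧ ⇒ ⟦ Δ ⨾ Γ ⟧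
      E = env Γ (K ∘ drop (os Γ')) f
      E' : ⟦ Δ' ▸ A ⨾ Γ' ⟧ ⇒ ⟦ Δ ▸ A ⨾ Γ ⟧
      E' = env Γ (K' ∘ drop (os Γ')) f'
      ins' : ⟦ Δ' ⨾ Γ' ⟧ ⇒ ⟦ Δ' ▸ A ⨾ Γ' ⟧
      ins' = ins (os Γ') id (g ∘ E)

      modal : ∀ {B} (u : (Δ ▸ A) ∋ B) →
              (mproj u ∘ drop (os Γ)) ∘ (E' ∘ ins') ≈ (mproj u ∘ drop (os Γ)) ∘ (ins (os Γ) id g ∘ E)
      modal here = begin
        (mproj {Δ ▸ A} here ∘ drop (os Γ)) ∘ (E' ∘ ins')
          ≈⟨ trans sym-assoc (mproj∘drop∘env {Δ = Δ ▸ A} {Γ = Γ} here ⟩∘⟨refl) ⟩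
        (mproj {Δ ▸ A} here ∘ (K' ∘ drop (os Γ'))) ∘ ins'
          ≈⟨ pullˡ top ⟩∘⟨refl ⟩
        (mproj {Δ' ▸ A} here ∘ drop (os Γ')) ∘ ins'
          ≈⟨ top∘ins {Δ = Δ'} {Γ = Γ'} {A = A} ⟩
        g ∘ E
          ≈⟨ top∘ins {Δ = Δ} {Γ = Γ} {A = A} ⟩∘⟨refl ⟨
        ((mproj {Δ ▸ A} here ∘ drop (os Γ)) ∘ ins (os Γ) id g) ∘ E
          ≈⟨ assoc ⟩
        (mproj {Δ ▸ A} here ∘ drop (os Γ)) ∘ (ins (os Γ) id g ∘ E) ∎
      modal (there u) = begin
        (mproj {Δ ▸ A} (there u) ∘ drop (os Γ)) ∘ (E' ∘ ins')
          ≈⟨ trans sym-assoc (mproj∘drop∘env {Δ = Δ ▸ A} {Γ = Γ} (there u) ⟩∘⟨refl) ⟩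
        (mproj {Δ ▸ A} (there u) ∘ (K' ∘ drop (os Γ'))) ∘ ins'
          ≈⟨ trans (pullˡ (pop u) ⟩∘⟨refl) assoc ⟩
        ((mproj u ∘ K) ∘ π₁) ∘ (drop (os Γ') ∘ ins')
          ≈⟨ refl⟩∘⟨ drop∘ins (os Γ') ⟩
        ((mproj u ∘ K) ∘ π₁) ∘ ⟨ drop (os Γ') ∘ id , g ∘ E ⟩
          ≈⟨ trans project₁-∘ (refl⟩∘⟨ identityʳ) ⟩
        (mproj u ∘ K) ∘ drop (os Γ')
          ≈⟨ trans (mproj∘drop∘env {Γ = Γ} u) sym-assoc ⟨
        (mproj u ∘ drop (os Γ)) ∘ E
          ≈⟨ trans (pop∘ins {Γ = Γ} {A = A} u) identityʳ ⟩∘⟨refl ⟨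
        ((mproj {Δ ▸ A} (there u) ∘ drop (os Γ)) ∘ ins (os Γ) id g) ∘ E
          ≈⟨ assoc ⟩
        (mproj {Δ ▸ A} (there u) ∘ drop (os Γ)) ∘ (ins (os Γ) id g ∘ E) ∎

      intuitionistic : ∀ {B} (x : Γ ∋ B) → iproj x ∘ (E' ∘ ins') ≈ iproj x ∘ (ins (os Γ) id g ∘ E)
      intuitionistic x = begin
        iproj x ∘ (E' ∘ ins')               ≈⟨ trans sym-assoc (iproj∘env x ⟩∘⟨refl) ⟩
        f' x ∘ ins'                         ≈⟨ ff x ⟩
        f x                                 ≈⟨ iproj∘env x ⟨
        iproj x ∘ E                         ≈⟨ trans (iproj∘ins x) identityʳ ⟩∘⟨refl ⟨
        (iproj x ∘ ins (os Γ) id g) ∘ E     ≈⟨ assoc ⟩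
        iproj x ∘ (ins (os Γ) id g ∘ E)     ∎

module BoxMaps {o ℓ e} (𝒦 : Kripke o ℓ e) (I : ℕ → Kripke.Obj 𝒦)
               (L : Logic) (X : Extra L 𝒦) where
  open Kripke 𝒦
  open CCCLemmas ccc
  open KripkeLemmas 𝒦
  open Model 𝒦 I L X

  m⁂id∘⟨⟩ : ∀ {Y A B C} {c : A ⇒ F₀ B} {p : Y ⇒ A} {q : Y ⇒ F₀ C} →
            (m ∘ (c ⁂ id)) ∘ ⟨ p , q ⟩ ≈ m ∘ ⟨ c ∘ p , q ⟩
  m⁂id∘⟨⟩ = trans assoc (refl⟩∘⟨ trans ⁂∘⟨⟩ (⟨⟩-cong refl identityˡ))

  mⁿ-iproj : ∀ {Δ A} (x : Δ ∋ A) → F₁ (iproj x) ∘ mⁿ (os Δ) ≈ mproj x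
  mⁿ-iproj here      = trans Fπ₂∘m∘⟨⟩ identityˡ
  mⁿ-iproj (there x) = trans (pushˡ F-∘) (trans (refl⟩∘⟨ Fπ₁∘m∘⟨⟩) (pullˡ (mⁿ-iproj x)))

  mⁿ-natural : ∀ {Δ Δ'} {E : ⟦ [] ⨾ Δ' ⟧ ⇒ ⟦ [] ⨾ Δ ⟧} {K : ⟦ Δ' ⨾ [] ⟧ ⇒ ⟦ Δ ⨾ [] ⟧} →
               (∀ {A} (x : Δ ∋ A) → F₁ (iproj x ∘ E) ∘ mⁿ (os Δ') ≈ mproj x ∘ K) →
               F₁ E ∘ mⁿ (os Δ') ≈ mⁿ (os Δ) ∘ K
  mⁿ-natural {Δ} h = FExt.ctx-ext [] Δ (λ ())
    (λ x → trans (trans sym-assoc (sym F-∘ ⟩∘⟨refl)) (trans (h x) (sym (pullˡ (mⁿ-iproj x)))))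

  mⁿ-ren : ∀ {Δ Δ'} (ρ₀ : Ren [] []) (ρ : Ren Δ Δ') →
           F₁ (⟦ren⟧ ρ₀ ρ) ∘ mⁿ (os Δ') ≈ mⁿ (os Δ) ∘ ⟦mren⟧ ρ
  mⁿ-ren {Δ} {Δ'} ρ₀ ρ = mⁿ-natural {Δ} {Δ'} (λ x →
    trans (F-resp-≈ (iproj∘env x) ⟩∘⟨refl) (trans (mⁿ-iproj (ρ x)) (sym (mproj∘menv x))))

  mⁿ-sub : ∀ {Δ Δ'} (ρ₀ : Ren [] []) (σ : Sub L [] Δ Δ') →
           F₁ (⟦sub⟧ ρ₀ σ) ∘ mⁿ (os Δ') ≈ mⁿ (os Δ) ∘ menv Δ (λ x → F₁ ⟦ σ x ⟧ ∘ mⁿ (os Δ'))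
  mⁿ-sub {Δ} {Δ'} ρ₀ σ = mⁿ-natural {Δ} {Δ'} (λ x →
    trans (F-resp-≈ (iproj∘env x) ⟩∘⟨refl) (sym (mproj∘menv x)))

  -- the components of  mExt ∘ into ⟨ a , b ⟩ , which with a = ∏ δ and b = id
  -- is the map  m^(2n) ∘ ⟨ δ π₁ , … , δ πₙ , π₁ , … , πₙ ⟩  defining f^#
  mExt∘into-iproj : ∀ {Y Δ A} (xs : SL Obj) {a : Y ⇒ Π (mapF xs)} {b : Y ⇒ ⟦ Δ ⨾ [] ⟧} (x : Δ ∋ A) →
                    F₁ (iproj x) ∘ (mExt xs (os Δ) ∘ into (mapF (os Δ)) a b) ≈ mproj x ∘ b
  mExt∘into-iproj xs here      = trans (refl⟩∘⟨ m⁂id∘⟨⟩) Fπ₂∘m∘⟨⟩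
  mExt∘into-iproj xs (there x) =
    trans (pushˡ F-∘) (trans (refl⟩∘⟨ trans (refl⟩∘⟨ m⁂id∘⟨⟩) Fπ₁∘m∘⟨⟩)
                             (trans (mExt∘into-iproj xs x) sym-assoc))

  mExt∘into-drop : ∀ {Y} Δ (xs : SL Obj) {a : Y ⇒ Π (mapF xs)} {b : Y ⇒ ⟦ Δ ⨾ [] ⟧} →
                   F₁ (drop (os Δ)) ∘ (mExt xs (os Δ) ∘ into (mapF (os Δ)) a b) ≈ mⁿ xs ∘ a
  mExt∘into-drop []      xs = trans (F-id ⟩∘⟨refl) identityˡ
  mExt∘into-drop (Δ ▸ A) xs =
    trans (pushˡ F-∘) (trans (refl⟩∘⟨ trans (refl⟩∘⟨ m⁂id∘⟨⟩) Fπ₁∘m∘⟨⟩) (mExt∘into-drop Δ xs))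

  module Comultiplication (δ : ∀ {A} → F₀ A ⇒ F₀ (F₀ A))
                          (δ-natural : ∀ {A B} {f : A ⇒ B} → F₁ (F₁ f) ∘ δ ≈ δ ∘ F₁ f)
                          (δ-δ : ∀ {A} → δ {F₀ A} ∘ δ {A} ≈ F₁ δ ∘ δ) where

    δ⋆ : ∀ Δ → ⟦ Δ ⨾ [] ⟧ ⇒ F₀ ⟦ Δ ⨾ [] ⟧
    δ⋆ Δ = mⁿ (mapF (os Δ)) ∘ δs δ (os Δ)

    δ# : ∀ Δ → ⟦ Δ ⨾ [] ⟧ ⇒ F₀ ⟦ Δ ⨾ Δ ⟧
    δ# Δ = mExt (mapF (os Δ)) (os Δ) ∘ into (mapF (os Δ)) (δs δ (os Δ)) id

    δ⋆-mproj : ∀ {Δ A} (u : Δ ∋ A) → F₁ (mproj u) ∘ δ⋆ Δ ≈ δ ∘ mproj u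
    δ⋆-mproj here      = trans (refl⟩∘⟨ m⁂id∘⟨⟩) Fπ₂∘m∘⟨⟩
    δ⋆-mproj {Δ ▸ B} (there u) =
      trans (pushˡ F-∘) (trans (refl⟩∘⟨ trans (refl⟩∘⟨ m⁂id∘⟨⟩) Fπ₁∘m∘⟨⟩)
                               (trans (refl⟩∘⟨ sym-assoc) (trans (pullˡ (δ⋆-mproj {Δ} u)) assoc)))

    δ#-iproj : ∀ {Δ A} (x : Δ ∋ A) → F₁ (iproj x) ∘ δ# Δ ≈ mproj x
    δ#-iproj {Δ} x = trans (mExt∘into-iproj (mapF (os Δ)) x) identityʳ

    δ#-drop : ∀ Δ → F₁ (drop (os Δ)) ∘ δ# Δ ≈ δ⋆ Δ
    δ#-drop Δ = mExt∘into-drop Δ (mapF (os Δ))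

    δ#-mproj : ∀ {Δ A} (u : Δ ∋ A) → F₁ (mproj u ∘ drop (os Δ)) ∘ δ# Δ ≈ δ ∘ mproj u
    δ#-mproj {Δ} u = trans (pushˡ F-∘) (trans (refl⟩∘⟨ δ#-drop Δ) (δ⋆-mproj u))

    δ-square : ∀ {Δ Z A} {h : ⟦ Δ ⨾ [] ⟧ ⇒ F₀ Z} {k : Z ⇒ F₀ ⟦ A ⟧ᵀ} (u : Δ ∋ A) →
               F₁ k ∘ h ≈ δ ∘ mproj u → F₁ (F₁ k) ∘ (F₁ h ∘ δ⋆ Δ) ≈ F₁ (F₁ k) ∘ (δ ∘ h)
    δ-square {Δ} {h = h} {k} u p = begin
      F₁ (F₁ k) ∘ (F₁ h ∘ δ⋆ Δ)   ≈⟨ pullˡ (F-compose p) ⟩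
      F₁ (δ ∘ mproj u) ∘ δ⋆ Δ     ≈⟨ pushˡ F-∘ ⟩
      F₁ δ ∘ (F₁ (mproj u) ∘ δ⋆ Δ) ≈⟨ refl⟩∘⟨ δ⋆-mproj u ⟩
      F₁ δ ∘ (δ ∘ mproj u)        ≈⟨ sym-assoc ⟩
      (F₁ δ ∘ δ) ∘ mproj u        ≈⟨ pullˡ δ-δ ⟨
      δ ∘ (δ ∘ mproj u)           ≈⟨ refl⟩∘⟨ p ⟨
      δ ∘ (F₁ k ∘ h)              ≈⟨ trans (pullˡ δ-natural) assoc ⟨
      F₁ (F₁ k) ∘ (δ ∘ h)         ∎

    proj-square : ∀ {Δ Z A} {h : ⟦ Δ ⨾ [] ⟧ ⇒ F₀ Z} {k : Z ⇒ ⟦ A ⟧ᵀ} (u : Δ ∋ A) →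
                  F₁ k ∘ h ≈ mproj u → F₁ (F₁ k) ∘ (F₁ h ∘ δ⋆ Δ) ≈ F₁ (F₁ k) ∘ (δ ∘ h)
    proj-square {Δ} {h = h} {k} u p = begin
      F₁ (F₁ k) ∘ (F₁ h ∘ δ⋆ Δ)   ≈⟨ pullˡ (F-compose p) ⟩
      F₁ (mproj u) ∘ δ⋆ Δ         ≈⟨ δ⋆-mproj u ⟩
      δ ∘ mproj u                 ≈⟨ refl⟩∘⟨ p ⟨
      δ ∘ (F₁ k ∘ h)              ≈⟨ trans (pullˡ δ-natural) assoc ⟨
      F₁ (F₁ k) ∘ (δ ∘ h)         ∎

    δ⋆-coalgebra : ∀ Δ → F₁ (δ⋆ Δ) ∘ δ⋆ Δ ≈ δ ∘ δ⋆ Δ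
    δ⋆-coalgebra Δ = FFExt.modal-ext Δ (λ u → δ-square u (δ⋆-mproj u))

    δ#-coalgebra : ∀ Δ → F₁ (δ# Δ) ∘ δ⋆ Δ ≈ δ ∘ δ# Δ
    δ#-coalgebra Δ = FFExt.ctx-ext Δ Δ (λ u → δ-square u (δ#-mproj u)) (λ x → proj-square x (δ#-iproj x))

    CoalgebraMorphism : ∀ Δ Δ' → ⟦ Δ' ⨾ [] ⟧ ⇒ ⟦ Δ ⨾ [] ⟧ → Set e
    CoalgebraMorphism Δ Δ' K = F₁ K ∘ δ⋆ Δ' ≈ δ⋆ Δ ∘ K

    coalgebra-morphism : ∀ {Δ Δ'} {K : ⟦ Δ' ⨾ [] ⟧ ⇒ ⟦ Δ ⨾ [] ⟧} →
                         (∀ {A} (u : Δ ∋ A) → F₁ (mproj u ∘ K) ∘ δ⋆ Δ' ≈ δ ∘ (mproj u ∘ K)) →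
                         CoalgebraMorphism Δ Δ' K
    coalgebra-morphism {Δ} h = FExt.modal-ext Δ
      (λ u → trans (trans sym-assoc (sym F-∘ ⟩∘⟨refl)) (trans (h u) (sym (trans (pullˡ (δ⋆-mproj u)) assoc))))

    coalgebra-morphism-mproj : ∀ {Δ Δ' A} {K : ⟦ Δ' ⨾ [] ⟧ ⇒ ⟦ Δ ⨾ [] ⟧} → CoalgebraMorphism Δ Δ' K →
                               (u : Δ ∋ A) → F₁ (mproj u ∘ K) ∘ δ⋆ Δ' ≈ δ ∘ (mproj u ∘ K)
    coalgebra-morphism-mproj K-mor u =
      trans (pushˡ F-∘) (trans (refl⟩∘⟨ K-mor) (trans (pullˡ (δ⋆-mproj u)) assoc))

    -- promoting along a coalgebra structure map yields a δ-compatible map;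
    -- so the boxes  f^* = F f ∘ δ⋆  and  f^# = F f ∘ δ#  commute with δ
    box-δ : ∀ {Δ Z W} {h : ⟦ Δ ⨾ [] ⟧ ⇒ F₀ Z} {f : Z ⇒ W} →
            F₁ h ∘ δ⋆ Δ ≈ δ ∘ h → F₁ (F₁ f ∘ h) ∘ δ⋆ Δ ≈ δ ∘ (F₁ f ∘ h)
    box-δ p = trans (pushˡ F-∘) (trans (refl⟩∘⟨ p) (trans (pullˡ δ-natural) assoc))

    menv-coalgebra : ∀ {Δ Δ'} {h : ∀ {A} → Δ ∋ A → ⟦ Δ' ⨾ [] ⟧ ⇒ F₀ ⟦ A ⟧ᵀ} →
                     (∀ {A} (u : Δ ∋ A) → F₁ (h u) ∘ δ⋆ Δ' ≈ δ ∘ h u) → CoalgebraMorphism Δ Δ' (menv Δ h)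
    menv-coalgebra {Δ} {Δ'} hδ = coalgebra-morphism {Δ} {Δ'} (λ u →
      trans (F-resp-≈ (mproj∘menv u) ⟩∘⟨refl) (trans (hδ u) (refl⟩∘⟨ sym (mproj∘menv u))))

    ⟦mren⟧-coalgebra : ∀ {Δ Δ'} (ρ : Ren Δ Δ') → CoalgebraMorphism Δ Δ' (⟦mren⟧ ρ)
    ⟦mren⟧-coalgebra {Δ} {Δ'} ρ = menv-coalgebra {Δ} {Δ'} (λ u → δ⋆-mproj (ρ u))

    δ#-natural : ∀ {Δ Δ'} {E : ⟦ Δ' ⨾ Δ' ⟧ ⇒ ⟦ Δ ⨾ Δ ⟧} {K : ⟦ Δ' ⨾ [] ⟧ ⇒ ⟦ Δ ⨾ [] ⟧} →
                 CoalgebraMorphism Δ Δ' K →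
                 (∀ {A} (u : Δ ∋ A) → (mproj u ∘ drop (os Δ)) ∘ E ≈ (mproj u ∘ K) ∘ drop (os Δ')) →
                 (∀ {A} (x : Δ ∋ A) → F₁ (iproj x ∘ E) ∘ δ# Δ' ≈ mproj x ∘ K) →
                 F₁ E ∘ δ# Δ' ≈ δ# Δ ∘ K
    δ#-natural {Δ} {Δ'} K-mor hm hi = FExt.ctx-ext Δ Δ
      (λ u → trans (pullˡ (F-compose (hm u)))
             (trans (pushˡ F-∘) (trans (refl⟩∘⟨ δ#-drop Δ')
             (trans (coalgebra-morphism-mproj {Δ} {Δ'} K-mor u) (sym (trans (pullˡ (δ#-mproj {Δ} u)) assoc))))))
      (λ x → trans (trans sym-assoc (sym F-∘ ⟩∘⟨refl)) (trans (hi x) (sym (pullˡ (δ#-iproj {Δ} x)))))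

    δ#-ren : ∀ {Δ Δ'} (ρ : Ren Δ Δ') → F₁ (⟦ren⟧ ρ ρ) ∘ δ# Δ' ≈ δ# Δ ∘ ⟦mren⟧ ρ
    δ#-ren {Δ} {Δ'} ρ = δ#-natural {Δ} {Δ'} (⟦mren⟧-coalgebra ρ)
      (λ u → trans (mproj∘drop∘env {Γ = Δ} u) sym-assoc)
      (λ x → trans (F-resp-≈ (iproj∘env x) ⟩∘⟨refl) (trans (δ#-iproj (ρ x)) (sym (mproj∘menv x))))

boxRenᴹ : ∀ L {Δ Δ'} → Ren Δ Δ' → Ren (BΔ L Δ) (BΔ L Δ')
boxRenᴹ LK  ρ = λ ()
boxRenᴹ LK4 ρ = ρ
boxRenᴹ LT  ρ = λ ()
boxRenᴹ LS4 ρ = ρ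

boxRenᴵ : ∀ L {Δ Δ'} → Ren Δ Δ' → Ren (BΓ L Δ) (BΓ L Δ')
boxRenᴵ LK  ρ = ρ
boxRenᴵ LK4 ρ = ρ
boxRenᴵ LT  ρ = ρ
boxRenᴵ LS4 ρ = λ ()

rnB≡rn : ∀ L {Δ Δ' A} (ρ : Ren Δ Δ') (M : Tm L (BΔ L Δ) (BΓ L Δ) A) →
         rnB L ρ M ≡.≡ rn (boxRenᴹ L ρ) (boxRenᴵ L ρ) M
rnB≡rn LK  ρ M = ≡.refl
rnB≡rn LK4 ρ M = ≡.refl
rnB≡rn LT  ρ M = ≡.refl
rnB≡rn LS4 ρ M = ≡.refl

rn-box : ∀ L {Δ Δ' Γ Γ' A} (ρ : Ren Δ Δ') (σ : Ren Γ Γ') (M : Tm L (BΔ L Δ) (BΓ L Δ) A) →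
         rn ρ σ (box {Γ = Γ} M) ≡.≡ box (rnB L ρ M)
rn-box LK  ρ σ M = ≡.refl
rn-box LK4 ρ σ M = ≡.refl
rn-box LT  ρ σ M = ≡.refl
rn-box LS4 ρ σ M = ≡.refl

module Soundness {o ℓ e} (𝒦 : Kripke o ℓ e) (I : ℕ → Kripke.Obj 𝒦) where
  open Kripke 𝒦
  open CCCLemmas ccc
  open KripkeLemmas 𝒦
  module M = Model 𝒦 I
  module B = BoxMaps 𝒦 I
  module K4 (X : Four 𝒦) = B.Comultiplication LK4 X (Four.δ X) (Four.δ-natural X) (Four.δ-4 X)
  module S4 (X : BdP 𝒦) = B.Comultiplication LS4 X (BdP.δ X) (BdP.δ-natural X) (BdP.comonad-assoc X)

  boxMap : ∀ L (X : Extra L 𝒦) Δ → M.⟦_⨾_⟧ L X Δ [] ⇒ F₀ (M.⟦_⨾_⟧ L X (BΔ L Δ) (BΓ L Δ))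
  boxMap LK  X Δ = M.mⁿ LK X (M.os LK X Δ)
  boxMap LK4 X Δ = K4.δ# X Δ
  boxMap LT  X Δ = M.mⁿ LT X (M.os LT X Δ)
  boxMap LS4 X Δ = S4.δ⋆ X Δ

  boxSem-factor : ∀ L X Δ {A} (f : M.⟦_⨾_⟧ L X (BΔ L Δ) (BΓ L Δ) ⇒ M.⟦_⟧ᵀ L X A) →
                  M.boxSem L X L X Δ {A} f ≈ F₁ f ∘ boxMap L X Δ
  boxSem-factor LK  X Δ f = refl
  boxSem-factor LK4 X Δ f = refl
  boxSem-factor LT  X Δ f = refl
  boxSem-factor LS4 X Δ f = refl

  boxSem-cong : ∀ L X Δ {A} {f g : M.⟦_⨾_⟧ L X (BΔ L Δ) (BΓ L Δ) ⇒ M.⟦_⟧ᵀ L X A} → f ≈ g →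
                M.boxSem L X L X Δ {A} f ≈ M.boxSem L X L X Δ {A} g
  boxSem-cong L X Δ {f = f} {g} p =
    trans (boxSem-factor L X Δ f) (trans (F-resp-≈ p ⟩∘⟨refl) (sym (boxSem-factor L X Δ g)))

  boxSem-∘ : ∀ L X {Δ Δ' A} {E : M.⟦_⨾_⟧ L X (BΔ L Δ') (BΓ L Δ') ⇒ M.⟦_⨾_⟧ L X (BΔ L Δ) (BΓ L Δ)}
             {K : M.⟦_⨾_⟧ L X Δ' [] ⇒ M.⟦_⨾_⟧ L X Δ []}
             (f : M.⟦_⨾_⟧ L X (BΔ L Δ) (BΓ L Δ) ⇒ M.⟦_⟧ᵀ L X A) →
             F₁ E ∘ boxMap L X Δ' ≈ boxMap L X Δ ∘ K →
             M.boxSem L X L X Δ' {A} (f ∘ E) ≈ M.boxSem L X L X Δ {A} f ∘ K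
  boxSem-∘ L X {Δ} {Δ'} {E = E} {K} f square = begin
    M.boxSem L X L X Δ' (f ∘ E)        ≈⟨ boxSem-factor L X Δ' (f ∘ E) ⟩
    F₁ (f ∘ E) ∘ boxMap L X Δ'         ≈⟨ pushˡ F-∘ ⟩
    F₁ f ∘ (F₁ E ∘ boxMap L X Δ')      ≈⟨ refl⟩∘⟨ square ⟩
    F₁ f ∘ (boxMap L X Δ ∘ K)          ≈⟨ sym-assoc ⟩
    (F₁ f ∘ boxMap L X Δ) ∘ K          ≈⟨ boxSem-factor L X Δ f ⟩∘⟨refl ⟨
    M.boxSem L X L X Δ f ∘ K           ∎

  boxMap-ren : ∀ L X {Δ Δ'} (ρ : Ren Δ Δ') →
               F₁ (M.⟦ren⟧ L X (boxRenᴹ L ρ) (boxRenᴵ L ρ)) ∘ boxMap L X Δ' ≈ boxMap L X Δ ∘ M.⟦mren⟧ L X ρ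
  boxMap-ren LK  X ρ = B.mⁿ-ren LK X (λ ()) ρ
  boxMap-ren LK4 X ρ = K4.δ#-ren X ρ
  boxMap-ren LT  X ρ = B.mⁿ-ren LT X (λ ()) ρ
  boxMap-ren LS4 X ρ = trans (F-resp-≈ identityʳ ⟩∘⟨refl) (S4.⟦mren⟧-coalgebra X ρ)

  boxSem-uId : ∀ L X {Δ A} (u : Δ ∋ A) → M.boxSem L X L X Δ {A} (M.⟦_⟧ L X (uId L u)) ≈ M.mproj L X u
  boxSem-uId LK  X u = B.mⁿ-iproj LK X u
  boxSem-uId LK4 X u = K4.δ#-iproj X u
  boxSem-uId LT  X u = B.mⁿ-iproj LT X u
  boxSem-uId LS4 X {Δ} u = begin
    F₁ ((ε ∘ mproj u) ∘ id) ∘ δ⋆ Δ  ≈⟨ F-resp-≈ identityʳ ⟩∘⟨refl ⟩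
    F₁ (ε ∘ mproj u) ∘ δ⋆ Δ         ≈⟨ pushˡ F-∘ ⟩
    F₁ ε ∘ (F₁ (mproj u) ∘ δ⋆ Δ)    ≈⟨ refl⟩∘⟨ δ⋆-mproj u ⟩
    F₁ ε ∘ (δ ∘ mproj u)            ≈⟨ pullˡ comonad-idʳ ⟩
    id ∘ mproj u                    ≈⟨ identityˡ ⟩
    mproj u                         ∎
    where open M LS4 X
          open S4 X
          open BdP X

  mvarSem-ren : ∀ L X (h : HasMVar L) {Δ Δ' A} (ρ : Ren Δ Δ') (u : Δ ∋ A) →
                M.mvarSem L X L X h (ρ u) ≈ M.mvarSem L X L X h u ∘ M.⟦mren⟧ L X ρ
  mvarSem-ren LT  X h ρ u = trans (refl⟩∘⟨ sym (M.mproj∘menv LT X u)) sym-assoc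
  mvarSem-ren LS4 X h ρ u = trans (refl⟩∘⟨ sym (M.mproj∘menv LS4 X u)) sym-assoc

  module Substitution (L : Logic) (X : Extra L 𝒦) where
    open M L X

    ⟦⟧-≡ : ∀ {Δ Γ A} {M N : Tm L Δ Γ A} → M ≡.≡ N → ⟦ M ⟧ ≈ ⟦ N ⟧
    ⟦⟧-≡ ≡.refl = refl

    ⟦mren⟧-liftR-here : ∀ {Δ Δ' A} (ρ : Ren Δ Δ') → mproj {Δ ▸ A} here ∘ ⟦mren⟧ (liftR {B = A} ρ) ≈ π₂
    ⟦mren⟧-liftR-here {A = A} ρ = mproj∘⟦mren⟧ (liftR {B = A} ρ) here

    ⟦mren⟧-liftR-there : ∀ {Δ Δ' A B} (ρ : Ren Δ Δ') (u : Δ ∋ B) →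
                         mproj {Δ ▸ A} (there u) ∘ ⟦mren⟧ (liftR {B = A} ρ) ≈ (mproj u ∘ ⟦mren⟧ ρ) ∘ π₁
    ⟦mren⟧-liftR-there {A = A} ρ u =
      trans (mproj∘⟦mren⟧ (liftR {B = A} ρ) (there u)) (sym (mproj∘⟦mren⟧ ρ u ⟩∘⟨refl))

    sem-rn : ∀ {Δ Δ' Γ Γ' A} (ρ : Ren Δ Δ') (σ : Ren Γ Γ') (M : Tm L Δ Γ A) →
             ⟦ rn ρ σ M ⟧ ≈ ⟦ M ⟧ ∘ ⟦ren⟧ ρ σ

    sem-rnB : ∀ {Δ Δ' A} (ρ : Ren Δ Δ') (M : Tm L (BΔ L Δ) (BΓ L Δ) A) →
              ⟦ rnB L ρ M ⟧ ≈ ⟦ M ⟧ ∘ ⟦ren⟧ (boxRenᴹ L ρ) (boxRenᴵ L ρ)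
    sem-rnB ρ M = trans (⟦⟧-≡ (rnB≡rn L ρ M)) (sem-rn (boxRenᴹ L ρ) (boxRenᴵ L ρ) M)

    sem-box-rn : ∀ {Δ Δ' A} (ρ : Ren Δ Δ') (M : Tm L (BΔ L Δ) (BΓ L Δ) A) →
                 boxSem L X Δ' {A} ⟦ rnB L ρ M ⟧ ≈ boxSem L X Δ {A} ⟦ M ⟧ ∘ ⟦mren⟧ ρ
    sem-box-rn {Δ' = Δ'} ρ M = trans (boxSem-cong L X Δ' (sem-rnB ρ M)) (boxSem-∘ L X ⟦ M ⟧ (boxMap-ren L X ρ))

    sem-rn ρ σ (var x)      = sym (iproj∘env x)
    sem-rn {Δ} {Δ'} {Γ} {Γ'} ρ σ (mvar h u) = modal-∘ {Δ} {Δ'} {Γ} {Γ'} (mvarSem-ren L X h ρ u)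
    sem-rn {Δ} {Δ'} {Γ} {Γ'} ρ σ (lam {A = A} M) =
      curry-∘′ (trans (sem-rn ρ (liftR σ) M) (refl⟩∘⟨ env-extend {Δ} {Δ'} {Γ} {Γ'} {A} (⟦mren⟧ ρ)
        {f = λ x → iproj (σ x)} {f' = λ x → iproj (liftR σ x)} refl (λ x → refl)))
    sem-rn ρ σ (app M N)    = app-∘ (sem-rn ρ σ M) (sem-rn ρ σ N)
    sem-rn ρ σ (pair M N)   = pair-∘ (sem-rn ρ σ M) (sem-rn ρ σ N)
    sem-rn ρ σ (prj₁ M)     = post-∘ (sem-rn ρ σ M)
    sem-rn ρ σ (prj₂ M)     = post-∘ (sem-rn ρ σ M)
    sem-rn {Δ} {Δ'} {Γ} {Γ'} ρ σ (box M) =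
      trans (⟦⟧-≡ (rn-box L ρ σ M)) (modal-∘ {Δ} {Δ'} {Γ} {Γ'} (sem-box-rn ρ M))
    sem-rn {Δ} {Δ'} {Γ} {Γ'} ρ σ (letbox {A = A} M N) =
      letbox-∘ {Δ} {Δ'} {Γ} {Γ'} {A} (sem-rn (liftR ρ) σ N) (sem-rn ρ σ M)
      (env-letbox {Δ} {Δ'} {Γ} {Γ'} {A} (⟦mren⟧-liftR-here {A = A} ρ) (⟦mren⟧-liftR-there {A = A} ρ)
                  (λ x → trans (iproj∘ins (σ x)) identityʳ))

    sem-lam-sub : ∀ {Δ Δ' Γ Γ' A B} (ρ : Ren Δ Δ') (σ : Sub L Δ' Γ Γ') (τ : Sub L Δ' (Γ ▸ A) (Γ' ▸ A))
                  (M : Tm L Δ (Γ ▸ A) B) → ⟦ sub ρ τ M ⟧ ≈ ⟦ M ⟧ ∘ ⟦sub⟧ ρ τ →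
                  ⟦ τ here ⟧ ≈ π₂ → (∀ {C} (x : Γ ∋ C) → ⟦ τ (there x) ⟧ ≈ ⟦ σ x ⟧ ∘ π₁) →
                  curry ⟦ sub ρ τ M ⟧ ≈ curry ⟦ M ⟧ ∘ ⟦sub⟧ ρ σ
    sem-lam-sub {Δ} {Δ'} {Γ} {Γ'} {A} ρ σ τ M ih τ-here τ-there = curry-∘′ (trans ih
      (refl⟩∘⟨ env-extend {Δ} {Δ'} {Γ} {Γ'} {A} (⟦mren⟧ ρ)
                 {f = λ x → ⟦ σ x ⟧} {f' = λ x → ⟦ τ x ⟧} τ-here τ-there))

    sem-sub : ∀ {Δ Δ' Γ Γ' A} (ρ : Ren Δ Δ') (σ : Sub L Δ' Γ Γ') (M : Tm L Δ Γ A) →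
              ⟦ sub ρ σ M ⟧ ≈ ⟦ M ⟧ ∘ ⟦sub⟧ ρ σ
    sem-sub ρ σ (var x)      = sym (iproj∘env x)
    sem-sub {Δ} {Δ'} {Γ} {Γ'} ρ σ (mvar h u) = modal-∘ {Δ} {Δ'} {Γ} {Γ'} (mvarSem-ren L X h ρ u)
    sem-sub {Δ} {Δ'} {Γ} {Γ'} ρ σ (lam {A = A} M) = sem-lam-sub ρ σ _ M (sem-sub ρ _ M) refl
      (λ x → trans (sem-rn (λ u → u) there (σ x)) (refl⟩∘⟨ ⟦ren⟧-there {Δ'} {Γ'} {A}))
    sem-sub ρ σ (app M N)    = app-∘ (sem-sub ρ σ M) (sem-sub ρ σ N)
    sem-sub ρ σ (pair M N)   = pair-∘ (sem-sub ρ σ M) (sem-sub ρ σ N)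
    sem-sub ρ σ (prj₁ M)     = post-∘ (sem-sub ρ σ M)
    sem-sub ρ σ (prj₂ M)     = post-∘ (sem-sub ρ σ M)
    sem-sub {Δ} {Δ'} {Γ} {Γ'} ρ σ (box M) = modal-∘ {Δ} {Δ'} {Γ} {Γ'} (sem-box-rn ρ M)
    sem-sub {Δ} {Δ'} {Γ} {Γ'} ρ σ (letbox {A = A} M N) =
      letbox-∘ {Δ} {Δ'} {Γ} {Γ'} {A} (sem-sub (liftR ρ) _ N) (sem-sub ρ σ M)
      (env-letbox {Δ} {Δ'} {Γ} {Γ'} {A} (⟦mren⟧-liftR-here {A = A} ρ) (⟦mren⟧-liftR-there {A = A} ρ)
        (λ x → trans (sem-rn there (λ y → y) (σ x) ⟩∘⟨refl)
                     (trans assoc (trans (refl⟩∘⟨ ⟦ren⟧-mthere∘ins {Δ'} {Γ'} {A}) identityʳ))))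

    ⟦msub⟧-mlift-ins : ∀ {Δ Δ' Γ A} (σ : MSub L Δ Δ') {g : ⟦ Δ ⨾ Γ ⟧ ⇒ F₀ ⟦ A ⟧ᵀ} →
                       ⟦msub⟧ {Γ = Γ} (mlift L {C = A} σ) ∘ ins (os Γ) id (g ∘ ⟦msub⟧ {Γ = Γ} σ)
                         ≈ ins (os Γ) id g ∘ ⟦msub⟧ {Γ = Γ} σ
    ⟦msub⟧-mlift-ins {Δ} {Δ'} {Γ} {A} σ = env-letbox {Δ} {Δ'} {Γ} {Γ} {A}
      (trans (mproj∘⟦msub⟧ᴹ (mlift L σ) here) (boxSem-uId L X here))
      (λ u → trans (mproj∘⟦msub⟧ᴹ (mlift L σ) (there u)) (trans (sem-box-rn there (σ u))
               (trans (refl⟩∘⟨ ⟦mren⟧-there {Δ'} {A}) (sym (mproj∘⟦msub⟧ᴹ σ u ⟩∘⟨refl)))))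
      (λ x → trans (iproj∘ins x) identityʳ)

  ⟦sub⟧-mvar-T : (X : Tee 𝒦) → ∀ Δ' Γ →
                 M.⟦sub⟧ LT X {[]} {Δ'} {Δ'} {Γ} (λ ()) (λ x → mvar tt x)
                   ≈ Tee.ε X ∘ (M.mⁿ LT X (M.os LT X Δ') ∘ M.drop LT X (M.os LT X Γ))
  ⟦sub⟧-mvar-T X Δ' Γ = IdExt.ctx-ext [] Δ' (λ ()) (λ x → trans (iproj∘env x) (sym (begin
      iproj x ∘ (ε ∘ (mⁿ (os Δ') ∘ drop (os Γ)))       ≈⟨ sym-assoc ⟩
      (iproj x ∘ ε) ∘ (mⁿ (os Δ') ∘ drop (os Γ))       ≈⟨ ε-natural ⟩∘⟨refl ⟩
      (ε ∘ F₁ (iproj x)) ∘ (mⁿ (os Δ') ∘ drop (os Γ))  ≈⟨ trans assoc (refl⟩∘⟨ pullˡ (mⁿ-iproj x)) ⟩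
      ε ∘ (mproj x ∘ drop (os Γ))                      ≈⟨ sym-assoc ⟩
      (ε ∘ mproj x) ∘ drop (os Γ)                      ∎)))
    where open M LT X
          open B LT X
          open Tee X

  msub-mvar-T : (X : Tee 𝒦) → ∀ {Δ Δ' Γ A} (σ : MSub LT Δ Δ') (u : Δ ∋ A) →
                M.⟦_⟧ LT X (msub {Γ = Γ} σ (mvar tt u))
                   ≈ M.⟦_⟧ LT X (mvar {Γ = Γ} tt u) ∘ M.⟦msub⟧ LT X {Γ = Γ} σ
  msub-mvar-T X {Δ} {Δ'} {Γ} σ u = begin
    ⟦ sub (λ ()) (λ x → mvar tt x) (σ u) ⟧
      ≈⟨ sem-sub {Γ' = Γ} (λ ()) (λ x → mvar tt x) (σ u) ⟩
    ⟦ σ u ⟧ ∘ ⟦sub⟧ {[]} {Δ'} {Δ'} {Γ} (λ ()) (λ x → mvar tt x)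
      ≈⟨ refl⟩∘⟨ ⟦sub⟧-mvar-T X Δ' Γ ⟩
    ⟦ σ u ⟧ ∘ (ε ∘ (mⁿ (os Δ') ∘ drop (os Γ)))
      ≈⟨ trans sym-assoc (ε-natural ⟩∘⟨refl) ⟩
    (ε ∘ F₁ ⟦ σ u ⟧) ∘ (mⁿ (os Δ') ∘ drop (os Γ))
      ≈⟨ trans assoc (trans (refl⟩∘⟨ sym-assoc) sym-assoc) ⟩
    (ε ∘ (F₁ ⟦ σ u ⟧ ∘ mⁿ (os Δ'))) ∘ drop (os Γ)
      ≈⟨ modal-∘ {Δ} {Δ'} {Γ} {Γ} (trans (refl⟩∘⟨ sym (mproj∘⟦msub⟧ᴹ σ u)) sym-assoc) ⟩
    ((ε ∘ mproj u) ∘ drop (os Γ)) ∘ ⟦msub⟧ {Γ = Γ} σ ∎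
    where open M LT X
          open B LT X
          open Substitution LT X
          open Tee X

  ε∘δ⋆ : (X : BdP 𝒦) → ∀ Δ → BdP.ε X ∘ S4.δ⋆ X Δ ≈ id
  ε∘δ⋆ X Δ = IdExt.modal-ext Δ (λ u → begin
      mproj u ∘ (ε ∘ δ⋆ Δ)         ≈⟨ trans sym-assoc (ε-natural ⟩∘⟨refl) ⟩
      (ε ∘ F₁ (mproj u)) ∘ δ⋆ Δ    ≈⟨ trans assoc (refl⟩∘⟨ δ⋆-mproj u) ⟩
      ε ∘ (δ ∘ mproj u)            ≈⟨ trans (pullˡ comonad-idˡ) identityˡ ⟩
      mproj u                      ≈⟨ identityʳ ⟨
      mproj u ∘ id                 ∎)
    where open M LS4 X
          open S4 X
          open BdP X

  msub-mvar-S4 : (X : BdP 𝒦) → ∀ {Δ Δ' Γ A} (σ : MSub LS4 Δ Δ') (u : Δ ∋ A) →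
                 M.⟦_⟧ LS4 X (msub {Γ = Γ} σ (mvar tt u))
                   ≈ M.⟦_⟧ LS4 X (mvar {Γ = Γ} tt u) ∘ M.⟦msub⟧ LS4 X {Γ = Γ} σ
  msub-mvar-S4 X {Δ} {Δ'} {Γ} σ u = begin
    ⟦ rn (λ v → v) (λ ()) (σ u) ⟧
      ≈⟨ sem-rn {Γ' = Γ} (λ v → v) (λ ()) (σ u) ⟩
    ⟦ σ u ⟧ ∘ (⟦mren⟧ {Δ'} (λ v → v) ∘ drop (os Γ))
      ≈⟨ refl⟩∘⟨ trans (⟦mren⟧-id {Δ'} ⟩∘⟨refl) identityˡ ⟩
    ⟦ σ u ⟧ ∘ drop (os Γ)
      ≈⟨ trans (refl⟩∘⟨ ε∘δ⋆ X Δ') identityʳ ⟩∘⟨refl ⟨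
    (⟦ σ u ⟧ ∘ (ε ∘ δ⋆ Δ')) ∘ drop (os Γ)
      ≈⟨ trans sym-assoc (trans (ε-natural ⟩∘⟨refl) assoc) ⟩∘⟨refl ⟩
    (ε ∘ (F₁ ⟦ σ u ⟧ ∘ δ⋆ Δ')) ∘ drop (os Γ)
      ≈⟨ modal-∘ {Δ} {Δ'} {Γ} {Γ} (trans (refl⟩∘⟨ sym (mproj∘⟦msub⟧ᴹ σ u)) sym-assoc) ⟩
    ((ε ∘ mproj u) ∘ drop (os Γ)) ∘ ⟦msub⟧ {Γ = Γ} σ ∎
    where open M LS4 X
          open S4 X
          open Substitution LS4 X
          open BdP X

  -- the box case for S4: the images of a modal substitution are boxes, hence δ-compatible
  msub-box-S4 : (X : BdP 𝒦) → ∀ {Δ Δ' Γ A} (σ : MSub LS4 Δ Δ') (B : Tm LS4 Δ [] A) →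
                M.⟦_⟧ LS4 X (msub σ B) ≈ M.⟦_⟧ LS4 X B ∘ M.⟦msub⟧ LS4 X {Γ = []} σ →
                M.⟦_⟧ LS4 X (msub {Γ = Γ} σ (box B)) ≈ M.⟦_⟧ LS4 X (box {Γ = Γ} B) ∘ M.⟦msub⟧ LS4 X {Γ = Γ} σ
  msub-box-S4 X {Δ} {Δ'} {Γ} {A} σ B ih = modal-∘ {Δ} {Δ'} {Γ} {Γ}
    (trans (boxSem-cong LS4 X Δ' {A} ih) (boxSem-∘ LS4 X {Δ} {Δ'} {A} ⟦ B ⟧ (trans (F-resp-≈ identityʳ ⟩∘⟨refl)
      (menv-coalgebra {Δ} {Δ'} (λ u → box-δ {Δ'} (δ⋆-coalgebra Δ'))))))
    where open M LS4 X
          open S4 X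

  -- the box case for K4: the body is substituted in both its modal and its
  -- intuitionistic context, and δ# is natural for the resulting map
  msub-box-K4 : (X : Four 𝒦) → ∀ {Δ Δ' Γ A} (σ : MSub LK4 Δ Δ') (B : Tm LK4 Δ Δ A) →
                M.⟦_⟧ LK4 X (msub σ B) ≈ M.⟦_⟧ LK4 X B ∘ M.⟦msub⟧ LK4 X {Γ = Δ} σ →
                M.⟦_⟧ LK4 X (msub {Γ = Γ} σ (box B)) ≈ M.⟦_⟧ LK4 X (box {Γ = Γ} B) ∘ M.⟦msub⟧ LK4 X {Γ = Γ} σ
  msub-box-K4 X {Δ} {Δ'} {Γ} {A} σ B ih = modal-∘ {Δ} {Δ'} {Γ} {Γ} (begin
    boxSem LK4 X Δ' {A} ⟦ sub (λ v → v) σ (msub σ B) ⟧  ≈⟨ boxSem-cong LK4 X Δ' {A} body ⟩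
    boxSem LK4 X Δ' {A} (⟦ B ⟧ ∘ E)                    ≈⟨ boxSem-∘ LK4 X {Δ} {Δ'} {A} ⟦ B ⟧ square ⟩
    boxSem LK4 X Δ {A} ⟦ B ⟧ ∘ ⟦msub⟧ᴹ σ               ∎)
    where
      open M LK4 X
      open K4 X
      open Substitution LK4 X

      Sᵢ : ⟦ Δ' ⨾ Δ' ⟧ ⇒ ⟦ Δ' ⨾ Δ ⟧
      Sᵢ = ⟦sub⟧ {Δ'} {Δ'} {Δ} {Δ'} (λ v → v) σ
      Sₘ : ⟦ Δ' ⨾ Δ ⟧ ⇒ ⟦ Δ ⨾ Δ ⟧
      Sₘ = ⟦msub⟧ {Γ = Δ} σ
      E : ⟦ Δ' ⨾ Δ' ⟧ ⇒ ⟦ Δ ⨾ Δ ⟧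
      E = Sₘ ∘ Sᵢ

      body : ⟦ sub (λ v → v) σ (msub σ B) ⟧ ≈ ⟦ B ⟧ ∘ E
      body = trans (sem-sub (λ v → v) σ (msub σ B)) (trans (ih ⟩∘⟨refl) assoc)

      modal : ∀ {C} (u : Δ ∋ C) → (mproj u ∘ drop (os Δ)) ∘ E ≈ (mproj u ∘ ⟦msub⟧ᴹ σ) ∘ drop (os Δ')
      modal u = begin
        (mproj u ∘ drop (os Δ)) ∘ E                 ≈⟨ sym-assoc ⟩
        ((mproj u ∘ drop (os Δ)) ∘ Sₘ) ∘ Sᵢ         ≈⟨ mproj∘drop∘env {Γ = Δ} u ⟩∘⟨refl ⟩
        (mproj u ∘ (⟦msub⟧ᴹ σ ∘ drop (os Δ))) ∘ Sᵢ  ≈⟨ trans assoc (refl⟩∘⟨ assoc) ⟩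
        mproj u ∘ (⟦msub⟧ᴹ σ ∘ (drop (os Δ) ∘ Sᵢ))  ≈⟨ refl⟩∘⟨ refl⟩∘⟨ drop∘⟦sub⟧ ⟩
        mproj u ∘ (⟦msub⟧ᴹ σ ∘ drop (os Δ'))        ≈⟨ sym-assoc ⟩
        (mproj u ∘ ⟦msub⟧ᴹ σ) ∘ drop (os Δ')        ∎
        where
          drop∘⟦sub⟧ : drop (os Δ) ∘ Sᵢ ≈ drop (os Δ')
          drop∘⟦sub⟧ = trans (drop∘env Δ) (trans (⟦mren⟧-id {Δ'} ⟩∘⟨refl) identityˡ)

      intuitionistic : ∀ {C} (x : Δ ∋ C) → F₁ (iproj x ∘ E) ∘ δ# Δ' ≈ mproj x ∘ ⟦msub⟧ᴹ σ
      intuitionistic x = trans (F-resp-≈ (trans (pullˡ (iproj∘env x)) (iproj∘env x)) ⟩∘⟨refl)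
                               (sym (mproj∘⟦msub⟧ᴹ σ x))

      square : F₁ E ∘ δ# Δ' ≈ δ# Δ ∘ ⟦msub⟧ᴹ σ
      square = δ#-natural {Δ} {Δ'} (menv-coalgebra {Δ} {Δ'} (λ u → box-δ {Δ'} (δ#-coalgebra Δ'))) modal intuitionistic

  sem-msub : ∀ L X {Δ Δ' Γ A} (σ : MSub L Δ Δ') (M : Tm L Δ Γ A) →
             M.⟦_⟧ L X (msub σ M) ≈ M.⟦_⟧ L X M ∘ M.⟦msub⟧ L X {Γ = Γ} σ
  sem-msub L X σ (var x)    = sym (M.iproj∘env L X x)
  sem-msub L X {Δ} {Δ'} {Γ} σ (lam {A = A} M) = M.curry-∘′ L X (trans (sem-msub L X σ M)
    (refl⟩∘⟨ M.env-extend L X {Δ} {Δ'} {Γ} {Γ} {A} (M.⟦msub⟧ᴹ L X σ)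
               {f = M.iproj L X} {f' = M.iproj L X} refl (λ x → refl)))
  sem-msub L X σ (app M N)  = M.app-∘ L X (sem-msub L X σ M) (sem-msub L X σ N)
  sem-msub L X σ (pair M N) = M.pair-∘ L X (sem-msub L X σ M) (sem-msub L X σ N)
  sem-msub L X σ (prj₁ M)   = M.post-∘ L X (sem-msub L X σ M)
  sem-msub L X σ (prj₂ M)   = M.post-∘ L X (sem-msub L X σ M)
  sem-msub L X {Δ} {Δ'} {Γ} σ (letbox {A = A} M N) =
    M.letbox-∘ L X {Δ} {Δ'} {Γ} {Γ} {A} (sem-msub L X (mlift L σ) N) (sem-msub L X σ M)
      (Substitution.⟦msub⟧-mlift-ins L X {Δ} {Δ'} {Γ} {A} σ)
  sem-msub LK  X σ (mvar () u)
  sem-msub LK4 X σ (mvar () u)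
  sem-msub LT  X {Γ = Γ} σ (mvar h u) = msub-mvar-T X {Γ = Γ} σ u
  sem-msub LS4 X {Γ = Γ} σ (mvar h u) = msub-mvar-S4 X {Γ = Γ} σ u
  sem-msub LK  X {Δ} {Δ'} {Γ} σ (box {A = A} B) = M.modal-∘ LK X {Δ} {Δ'} {Γ} {Γ}
    (trans (boxSem-cong LK X Δ' {A} (Substitution.sem-sub LK X (λ ()) σ B))
           (boxSem-∘ LK X {Δ} {Δ'} {A} _ (B.mⁿ-sub LK X {Δ} {Δ'} (λ ()) σ)))
  sem-msub LT  X {Δ} {Δ'} {Γ} σ (box {A = A} B) = M.modal-∘ LT X {Δ} {Δ'} {Γ} {Γ}
    (trans (boxSem-cong LT X Δ' {A} (Substitution.sem-sub LT X (λ ()) σ B))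
           (boxSem-∘ LT X {Δ} {Δ'} {A} _ (B.mⁿ-sub LT X {Δ} {Δ'} (λ ()) σ)))
  sem-msub LK4 X {Γ = Γ} σ (box B) = msub-box-K4 X {Γ = Γ} σ B (sem-msub LK4 X σ B)
  sem-msub LS4 X {Γ = Γ} σ (box B) = msub-box-S4 X {Γ = Γ} σ B (sem-msub LS4 X σ B)

  module Validity (L : Logic) (X : Extra L 𝒦) where
    open M L X
    open Substitution L X

    ⟦msingle⟧ : ∀ {Δ Γ A} (M : Tm L (BΔ L Δ) (BΓ L Δ) A) →
                ⟦msub⟧ {Γ = Γ} (msingle L M) ≈ ins (os Γ) id (boxSem L X Δ {A} ⟦ M ⟧ ∘ drop (os Γ))
    ⟦msingle⟧ {Δ} {Γ} {A} M = IdExt.ctx-ext (Δ ▸ A) Γ modal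
        (λ x → trans (iproj∘env x) (sym (trans (iproj∘ins x) identityʳ)))
      where
        modal : ∀ {B} (u : (Δ ▸ A) ∋ B) → (mproj u ∘ drop (os Γ)) ∘ ⟦msub⟧ {Γ = Γ} (msingle L M)
                  ≈ (mproj u ∘ drop (os Γ)) ∘ ins (os Γ) id (boxSem L X Δ {A} ⟦ M ⟧ ∘ drop (os Γ))
        modal here      = trans (mproj∘drop∘env {Δ = Δ ▸ A} {Γ = Γ} here)
          (trans (pullˡ (mproj∘⟦msub⟧ᴹ (msingle L M) here)) (sym (top∘ins {Δ = Δ} {Γ = Γ} {A = A})))
        modal (there u) = trans (mproj∘drop∘env {Δ = Δ ▸ A} {Γ = Γ} (there u))
          (trans (pullˡ (trans (mproj∘⟦msub⟧ᴹ (msingle L M) (there u)) (boxSem-uId L X u)))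
                 (sym (trans (pop∘ins {Γ = Γ} {A = A} u) identityʳ)))

    sound : ∀ {Δ Γ A} {M N : Tm L Δ Γ A} → L ⊢ M ≐ N → ⟦ M ⟧ ≈ ⟦ N ⟧
    sound ≐refl         = refl
    sound (≐sym p)      = sym (sound p)
    sound (≐trans p q)  = trans (sound p) (sound q)
    sound (cong-lam p)  = curry-cong (sound p)
    sound (cong-app p q) = refl⟩∘⟨ ⟨⟩-cong (sound p) (sound q)
    -- β for functions: both sides are ⟦M⟧ ∘ ⟨ id , ⟦N⟧ ⟩
    sound {Δ} {Γ} (β⇒ {M = M} {N}) =
      trans eval-curry (sym (trans (sem-sub (λ u → u) (single N) M) (refl⟩∘⟨ ⟨⟩-cong (⟦ren⟧-id {Δ} {Γ}) refl)))
    -- η for functions: weakening is π₁, then the exponential's η-law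
    sound {Δ} {Γ} (η⇒ {A = A} {M = M}) = sym (trans
      (curry-cong (refl⟩∘⟨ ⟨⟩-cong (trans (sem-rn (λ u → u) there M) (refl⟩∘⟨ ⟦ren⟧-there {Δ} {Γ} {A}))
                                   refl))
      curry-η)
    -- η for boxes: the box of  u  projects onto u, which ins makes ⟦M⟧
    sound {Δ} {Γ} (η□ {A = A}) =
      trans (boxSem-uId L X here ⟩∘⟨refl ⟩∘⟨refl) (top∘ins {Δ = Δ} {Γ = Γ} {A = A})
    sound {Γ = Γ} (cong-let p q) = ∘-resp-≈ (sound q) (ins-cong (os Γ) (sound p))
    sound {Γ = Γ} (β□ {M = M} {N}) = sym (trans (sem-msub L X (msingle L M) N) (refl⟩∘⟨ ⟦msingle⟧ {Γ = Γ} M))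
    sound {Δ} (cong-box {A = A} p) = boxSem-cong L X Δ {A} (sound p) ⟩∘⟨refl

theorem10 : ∀ {o ℓ e : Level} (L : Logic) (𝒦 : Kripke o ℓ e) (X : Extra L 𝒦)
              (I : ℕ → Kripke.Obj 𝒦) {Δ Γ : Ctx} {A : Ty} {M N : Tm L Δ Γ A} →
              L ⊢ M ≐ N →
              Kripke._≈_ 𝒦 (Semantics.⟦_⟧ L 𝒦 X I M) (Semantics.⟦_⟧ L 𝒦 X I N)
theorem10 L 𝒦 X I = Soundness.Validity.sound 𝒦 I L X
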